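{- Let $n\ge1$, let $\alpha,\beta_1,\dots,\beta_n,\gamma$ be multiplicative characters of $\mathbb{F}_q$, and let $i\in\{0,1,\dots,n-1\}$, $\lambda_1,\dots,\lambda_i,x\in\mathbb{F}_q$. Write $B=\beta_{i+1}\cdots\beta_n$. (i) If $B\neq\varepsilon$, then $$F_D^{(n)}(\alpha;\beta_1,\dots,\beta_n;\gamma;\lambda_1,\dots,\lambda_i,x,\dots,x)=F_D^{(i+1)}(\alpha;\beta_1,\dots,\beta_i,B;\gamma;\lambda_1,\dots,\lambda_i,x).$$ In particular, if $\beta_1\cdots\beta_n\neq\varepsilon$, then $F_D^{(n)}(\alpha;\beta_1,\dots,\beta_n;\gamma;x,\dots,x)={}_2F_1(\alpha,\beta_1\cdots\beta_n;\gamma;x)$. (ii) If $B\notin\{\varepsilon,\overline{\alpha}\gamma\}$, then $$F_D^{(n)}(\alpha;\beta_1,\dots,\beta_n;\gamma;\lambda_1,\dots,\lambda_i,1,\dots,1)=\frac{g^\circ(\gamma)\,g(\overline{\alpha B}\gamma)}{g^\circ(\overline{\alpha}\gamma)\,g^\circ(\overline{B}\gamma)}\,F_D^{(i)}(\alpha;\beta_1,\dots,\beta_i;\overline{B}\gamma;\lambda_1,\dots,\lambda_i).$$ In particular, if $\beta_1\cdots\beta_n\notin\{\varepsilon,\overline{\alpha}\gamma\}$, then, with $C=\beta_1\cdots\beta_n$, $$F_D^{(n)}(\alpha;\beta_1,\dots,\beta_n;\gamma;1,\dots,1)=\frac{g^\circ(\gamma)\,g(\overline{\alpha C}\gamma)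}{g^\circ(\overline{\alpha}\gamma)\,g^\circ(\overline{C}\gamma)}.$$
   Context: Let $\mathbb{F}_q$ be a finite field with $q$ elements. Let $\widehat{\mathbb{F}_q^\times}=\mathrm{Hom}(\mathbb{F}_q^\times,\overline{\mathbb{Q}}^\times)$ be the group of multiplicative characters; $\varepsilon$ is the trivial character. Every character $\eta$ (including $\varepsilon$) is extended by $\eta(0)=0$; $\overline{\eta}=\eta^{ -1}$; products of characters are pointwise (e.g. $\overline{\alpha B}=(\alpha B)^{ -1}$). Put $\delta(\eta)=1$ if $\eta=\varepsilon$ and $0$ otherwise. Fix a nontrivial additive character $\psi$ of $\mathbb{F}_q$. Gauss sums: $g(\eta)=-\sum_{x\in\mathbb{F}_q^\times}\psi(x)\eta(x)$, $g^\circ(\eta)=q^{\delta(\eta)}g(\eta)$. For characters $a,\mu$: $(a)_\mu=g(a\mu)/g(a)$, $(a)^\circ_\mu=g^\circ(a\mu)/g^\circ(a)$. For $m\ge1$ and $\lambda_j\in\mathbb{F}_q$, Lauricella's function $$F_D^{(m)}(\alpha;\beta_1,\dots,\beta_m;\gamma;\lambda_1,\dots,\lambda_m)=\frac{1}{(1-q)^m}\sum_{\nu_1,\dots,\nu_m\in\widehat{\mathbb{F}_q^\times}}\frac{(\alpha)_{\nu_1\cdots\nu_m}\prod_{j=1}^m(\beta_j)_{\nu_j}}{(\gamma)^\circ_{\nu_1\cdots\nu_m}\prod_{j=1}^m(\varepsilon)^\circ_{\nu_j}}\prod_{j=1}^m\nu_j(\lambda_j),$$ and by convention $F_D^{(0)}=1$.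 Also ${}_2F_1(a,b;c;\lambda)=\frac{1}{1-q}\sum_{\nu}\frac{(a)_\nu(b)_\nu}{(\varepsilon)^\circ_\nu(c)^\circ_\nu}\nu(\lambda)$ (which equals $F_D^{(1)}(a;b;c;\lambda)$). -}

module Defs where

open import Data.Nat as ℕ using (ℕ; zero; suc; _<_; _∸_; _<?_)
open import Data.Fin using (Fin; toℕ; fromℕ<; inject≤)
open import Data.Bool using (Bool; true; false; if_then_else_; _∨_)
open import Data.List using (List; []; _∷_; length; filter; map)
open import Data.Bool.ListAction using (and)
open import Data.Nat.Properties using (<⇒≤)
open import Data.List.Membership.Propositional using (_∈_)
open import Data.List.Relation.Unary.All using (All)
open import Data.List.Relation.Unary.Any using (Any)
open import Data.List.Relation.Unary.Unique.Propositional using (Unique)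
open import Data.List.Relation.Unary.AllPairs using (AllPairs)
open import Data.Product using (∃)
open import Data.Vec.Functional as V using (Vector)
open import Relation.Binary.PropositionalEquality using (_≡_; _≢_)
open import Relation.Binary.Definitions using (DecidableEquality)
open import Relation.Nullary using (¬_; ¬?; does)
open import Algebra.Structures using (IsCommutativeRing)

-- Equality is propositional; the inverse is made total by 0⁻¹ = 0
-- (it is only ever applied to nonzero elements in the statement:
-- Gauss sums and 1 - q are nonzero).

record Field : Set₁ where
  infixl 6 _+_
  infixl 7 _*_
  infix  8 -_
  field
    Carrier : Set
    _+_ _*_ : Carrier → Carrier → Carrier
    -_ : Carrier → Carrier
    0# 1# : Carrier
    _⁻¹ : Carrier → Carrier
    isCommutativeRing : IsCommutativeRing _≡_ _+_ _*_ -_ 0# 1#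
    0≢1 : 0# ≢ 1#
    ⁻¹-inverse : ∀ x → x ≢ 0# → x * (x ⁻¹) ≡ 1#
    ⁻¹-zero : 0# ⁻¹ ≡ 0#
    _≟_ : DecidableEquality Carrier

ι : (K : Field) → ℕ → Field.Carrier K
ι K zero    = Field.0# K
ι K (suc n) = Field._+_ K (Field.1# K) (ι K n)

-- The standing setting: a finite field 𝔽 = F_q, a field 𝕂 of
-- characteristic 0 playing the role of \overline{ℚ}, the full group of
-- multiplicative characters F_q^× → 𝕂^× (extended by 0 at 0),
-- enumerated without repetition, and a nontrivial additive character ψ.

module _ (F K : Field) where
  private
    module F = Field F
    module K = Field K

  record IsMChar (η : F.Carrier → K.Carrier) : Set where
    field
      at-0   : η F.0# ≡ K.0#
      at-1   : η F.1# ≡ K.1#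
      mult   : ∀ x y → η (x F.* y) ≡ η x K.* η y

  _≗ᶜ_ : (F.Carrier → K.Carrier) → (F.Carrier → K.Carrier) → Set
  η ≗ᶜ μ = ∀ x → η x ≡ μ x

record Setting : Set₁ where
  field
    𝔽 𝕂 : Field
  private
    module F = Field 𝔽
    module K = Field 𝕂
  field
    elems          : List F.Carrier
    elems-complete : ∀ x → x ∈ elems
    elems-unique   : Unique elems
    char0 : ∀ n → ι 𝕂 (suc n) ≢ K.0#
    -- the group of multiplicative characters, enumerated (each
    -- character occurs exactly once up to pointwise equality); it has
    -- q - 1 elements, as it does for 𝕂 = \overline{ℚ}
    chars          : List (F.Carrier → K.Carrier)
    chars-char     : All (IsMChar 𝔽 𝕂) chars
    chars-complete : ∀ η → IsMChar 𝔽 𝕂 η → Any (λ ν → _≗ᶜ_ 𝔽 𝕂 η ν) chars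
    chars-distinct : AllPairs (λ ν μ → ¬ (_≗ᶜ_ 𝔽 𝕂 ν μ)) chars
    chars-count    : length chars ≡ length elems ∸ 1
    ψ            : F.Carrier → K.Carrier
    ψ-zero       : ψ F.0# ≡ K.1#
    ψ-add        : ∀ x y → ψ (x F.+ y) ≡ ψ x K.* ψ y
    ψ-nontrivial : ∃ λ x → ψ x ≢ K.1#

module Theory (S : Setting) where
  open Setting S
  module F = Field 𝔽
  module K = Field 𝕂

  Ch : Set
  Ch = F.Carrier → K.Carrier

  q : ℕ
  q = length elems

  sumL : {A : Set} → List A → (A → K.Carrier) → K.Carrier
  sumL []       f = K.0#
  sumL (a ∷ as) f = f a K.+ sumL as f

  prodK : {m : ℕ} → (Fin m → K.Carrier) → K.Carrier
  prodK = V.foldr K._*_ K.1#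

  powK : K.Carrier → ℕ → K.Carrier
  powK a zero    = K.1#
  powK a (suc n) = a K.* powK a n

  units : List F.Carrier
  units = filter (λ x → ¬? (x F.≟ F.0#)) elems

  ε : Ch
  ε x = if does (x F.≟ F.0#) then K.0# else K.1#

  _·_ : Ch → Ch → Ch
  (η · μ) x = η x K.* μ x

  bar : Ch → Ch
  bar η x = (η x) K.⁻¹

  prodCh : {m : ℕ} → (Fin m → Ch) → Ch
  prodCh = V.foldr _·_ ε

  isTrivial : Ch → Bool
  isTrivial η = and (map (λ x → does (x F.≟ F.0#) ∨ does (η x K.≟ ε x)) elems)

  g : Ch → K.Carrier
  g η = K.- sumL units (λ x → ψ x K.* η x)

  g° : Ch → K.Carrier
  g° η = if isTrivial η then ι 𝕂 q K.* g η else g η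

  poch : Ch → Ch → K.Carrier
  poch a μ = g (a · μ) K.* (g a) K.⁻¹

  poch° : Ch → Ch → K.Carrier
  poch° a μ = g° (a · μ) K.* (g° a) K.⁻¹

  sumTuples : (m : ℕ) → ((Fin m → Ch) → K.Carrier) → K.Carrier
  sumTuples zero    f = f (λ ())
  sumTuples (suc m) f = sumL chars (λ ν → sumTuples m (λ νs → f (ν V.∷ νs)))

  -- Lauricella's F_D^{(m)}; F_D^{(0)} = 1 by convention
  FD : (m : ℕ) → Ch → (Fin m → Ch) → Ch → (Fin m → F.Carrier) → K.Carrier
  FD zero    α β γ λs = K.1#
  FD (suc m) α β γ λs =
    (powK (K.1# K.+ K.- ι 𝕂 q) (suc m)) K.⁻¹ K.*
    sumTuples (suc m) (λ ν →
      let N = prodCh ν in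
      poch α N K.* prodK (λ j → poch (β j) (ν j))
        K.* (poch° γ N K.* prodK (λ j → poch° ε (ν j))) K.⁻¹
        K.* prodK (λ j → ν j (λs j)))

  F21 : Ch → Ch → Ch → F.Carrier → K.Carrier
  F21 a b c λ₀ =
    (K.1# K.+ K.- ι 𝕂 q) K.⁻¹ K.*
    sumL chars (λ ν →
      poch a ν K.* poch b ν K.* (poch° ε ν K.* poch° c ν) K.⁻¹ K.* ν λ₀)

  takeI : {A : Set} {i n : ℕ} → i < n → (Fin n → A) → Fin i → A
  takeI i<n v j = v (inject≤ j (<⇒≤ i<n))

  fillI : {A : Set} {i n : ℕ} → i < n → (Fin i → A) → A → Fin n → A
  fillI {i = i} i<n v x j with toℕ j <? i
  ... | Relation.Nullary.yes p = v (fromℕ< p)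
  ... | Relation.Nullary.no _  = x

  snocI : {A : Set} {i : ℕ} → (Fin i → A) → A → Fin (suc i) → A
  snocI {i = i} v b j with toℕ j <? i
  ... | Relation.Nullary.yes p = v (fromℕ< p)
  ... | Relation.Nullary.no _  = b

  prodFrom : {n : ℕ} → ℕ → (Fin n → Ch) → Ch
  prodFrom i β = prodCh (λ j → if does (toℕ j <? i) then ε else β j)

  const : {A : Set} {m : ℕ} → A → Fin m → A
  const x _ = x

-- The proof runs through a finite-field Euler integral
--   F_D(α; β; γ; λ) = Σ_s K_{α,γ}(s) ∏_j E_{β_j}((s λ_j)⁻¹),
-- obtained by writing (a)_ν / (c)°_ν as Σ_t K_{a,c}(t) ν(t) for an explicit beta kernel K (a Jacobi-sum
-- computation) and then summing over the characters ν_j with orthogonality. The binomial kernels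
-- E_b(t) = -K_{b,ε}(t) multiply like characters as long as the product is nontrivial, so the factors
-- sharing the argument x merge into E_B: this is (i). At x = 1 the factor E_B(s⁻¹) is absorbed into
-- K_{α,γ}(s), which turns it into K_{α,B̄γ}(s) times the Gauss sum quotient: this is (ii).
-- Orthogonality Σ_ν ν(y) = (q - 1)[y = 1] is not assumed; for the given enumeration of characters it
-- follows from translation invariance (each sum is 0 or q - 1), the total Σ_y Σ_ν ν(y) = q - 1, and
-- the absence of cancellation in characteristic 0.

module Submission where

open import Defs
open import Data.Nat using (ℕ; suc; _<_; _≤_)
open import Data.Fin using (Fin)
open import Data.Product using (_×_)
open import Relation.Binary.PropositionalEquality using (_≡_)
open import Relation.Nullary using (¬_)

import Algebra.Properties.CommutativeSemigroup as CommutativeSemigroupProperties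
import Algebra.Properties.Ring as RingProperties
import Algebra.Solver.Ring.NaturalCoefficients.Default as NaturalCoefficientsSolver
import Data.List.Relation.Unary.All.Properties as All
import Data.List.Relation.Unary.AllPairs.Properties as AllPairs
import Data.List.Relation.Unary.Any.Properties as Any
open import Algebra.Bundles using (CommutativeRing)
open import Data.Bool using (Bool; true; false; if_then_else_; _∨_; T)
open import Data.Bool.ListAction using (and)
open import Data.Bool.Properties using (T-≡; T-∨)
open import Data.Empty using (⊥; ⊥-elim)
open import Data.Fin using (zero; suc; toℕ; inject≤)
open import Data.Fin.Properties using (toℕ-injective; toℕ<n; toℕ-fromℕ<; toℕ-inject≤)
open import Data.List using (List; []; _∷_; map; length; filter)
open import Data.List.Properties using (map-cong)
open import Data.List.Relation.Unary.All using (All; []; _∷_; all?; lookup; lookupWith; tabulate) renaming (map to mapAll)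
open import Data.List.Relation.Unary.All.Properties using (all⁺; all⁻)
open import Data.List.Relation.Unary.AllPairs using (AllPairs; []; _∷_) renaming (map to mapAllPairs)
open import Data.List.Relation.Unary.Any using (Any; here; there; any?; satisfied) renaming (map to mapAny)
open import Data.Nat using (zero; _∸_; _<?_; s≤s) renaming (_+_ to _+ℕ_)
open import Data.Nat.Properties using (<⇒≤; n≤1+n)
open import Data.Product using (_,_; ∃)
open import Data.Sum using (_⊎_; inj₁; inj₂; map₂) renaming (map to map⊎)
open import Data.Vec.Functional using () renaming (_∷_ to _∷ᵛ_)
open import Function.Bundles using (Equivalence)
open import Relation.Binary.PropositionalEquality using (_≢_; refl; sym; trans; cong; cong₂; subst; module ≡-Reasoning)
open import Relation.Nullary using (yes; no; does; Dec; ¬?)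
open import Relation.Nullary.Decidable using (map′; decidable-stable)
open import Relation.Unary using (Decidable)

module FieldProperties (K : Field) where
  open Field K public
  open ≡-Reasoning

  commutativeRing : CommutativeRing _ _
  commutativeRing = record { isCommutativeRing = isCommutativeRing }

  open CommutativeRing commutativeRing public
    using (+-comm; +-assoc; +-identityˡ; +-identityʳ; -‿inverseˡ; -‿inverseʳ;
           *-comm; *-assoc; *-identityˡ; *-identityʳ; distribˡ; zeroˡ; zeroʳ)
  open RingProperties (CommutativeRing.ring commutativeRing) public
    using (-‿distribˡ-*; -‿distribʳ-*; -‿involutive; -‿injective; -1*x≈-x; -0#≈0#;
           +-cancelʳ; +-inverseˡ-unique)
  open CommutativeSemigroupProperties (CommutativeRing.*-commutativeSemigroup commutativeRing) public
    using (interchange; x∙yz≈y∙xz; x∙yz≈z∙xy; x∙yz≈yx∙z; x∙yz≈xz∙y)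
  module Solver = NaturalCoefficientsSolver (CommutativeRing.commutativeSemiring commutativeRing)

  -1# : Carrier
  -1# = - 1#

  -x≡-1*x : ∀ x → - x ≡ -1# * x
  -x≡-1*x x = sym (-1*x≈-x x)

  -1*-1≡1 : -1# * -1# ≡ 1#
  -1*-1≡1 = trans (-1*x≈-x -1#) (-‿involutive 1#)

  -x*-y≡x*y : ∀ x y → (- x) * (- y) ≡ x * y
  -x*-y≡x*y x y = trans (sym (-‿distribˡ-* x (- y))) (trans (cong -_ (sym (-‿distribʳ-* x y))) (-‿involutive _))

  1≢0 : 1# ≢ 0#
  1≢0 e = 0≢1 (sym e)

  ⁻¹-inverseʳ : ∀ x → x ≢ 0# → x * x ⁻¹ ≡ 1#
  ⁻¹-inverseʳ = ⁻¹-inverse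

  ⁻¹-inverseˡ : ∀ x → x ≢ 0# → x ⁻¹ * x ≡ 1#
  ⁻¹-inverseˡ x x≢0 = trans (*-comm _ _) (⁻¹-inverseʳ x x≢0)

  *-cancelˡ-⁻¹ : ∀ x y z → x ≢ 0# → x * y ≡ z → y ≡ x ⁻¹ * z
  *-cancelˡ-⁻¹ x y z x≢0 xy≡z = begin
    y              ≡⟨ sym (*-identityˡ y) ⟩
    1# * y         ≡⟨ cong (_* y) (sym (⁻¹-inverseˡ x x≢0)) ⟩
    (x ⁻¹ * x) * y ≡⟨ *-assoc _ _ _ ⟩
    x ⁻¹ * (x * y) ≡⟨ cong (x ⁻¹ *_) xy≡z ⟩
    x ⁻¹ * z       ∎

  x*x⁻¹*y≡y : ∀ x y → x ≢ 0# → x * (x ⁻¹ * y) ≡ y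
  x*x⁻¹*y≡y x y x≢0 = trans (sym (*-assoc _ _ _)) (trans (cong (_* y) (⁻¹-inverseʳ x x≢0)) (*-identityˡ y))

  x*y≡0⇒x≡0∨y≡0 : ∀ x y → x * y ≡ 0# → x ≡ 0# ⊎ y ≡ 0#
  x*y≡0⇒x≡0∨y≡0 x y xy≡0 with x ≟ 0#
  ... | yes x≡0 = inj₁ x≡0
  ... | no  x≢0 = inj₂ (trans (*-cancelˡ-⁻¹ x y _ x≢0 xy≡0) (zeroʳ _))

  *-≢0 : ∀ {x y} → x ≢ 0# → y ≢ 0# → x * y ≢ 0#
  *-≢0 {x} {y} x≢0 y≢0 xy≡0 with x*y≡0⇒x≡0∨y≡0 x y xy≡0
  ... | inj₁ x≡0 = x≢0 x≡0
  ... | inj₂ y≡0 = y≢0 y≡0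

  ⁻¹-unique : ∀ x y → x * y ≡ 1# → y ≡ x ⁻¹
  ⁻¹-unique x y xy≡1 with x ≟ 0#
  ... | yes x≡0 = ⊥-elim (0≢1 (trans (sym (zeroˡ y)) (trans (cong (_* y) (sym x≡0)) xy≡1)))
  ... | no  x≢0 = trans (*-cancelˡ-⁻¹ x y 1# x≢0 xy≡1) (*-identityʳ _)

  1⁻¹≡1 : 1# ⁻¹ ≡ 1#
  1⁻¹≡1 = sym (⁻¹-unique 1# 1# (*-identityˡ 1#))

  ⁻¹-≢0 : ∀ x → x ≢ 0# → x ⁻¹ ≢ 0#
  ⁻¹-≢0 x x≢0 x⁻¹≡0 = 1≢0 (trans (sym (⁻¹-inverseʳ x x≢0)) (trans (cong (x *_) x⁻¹≡0) (zeroʳ x)))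

  ⁻¹-involutive : ∀ x → x ⁻¹ ⁻¹ ≡ x
  ⁻¹-involutive x with x ≟ 0#
  ... | yes refl = trans (cong _⁻¹ ⁻¹-zero) ⁻¹-zero
  ... | no  x≢0 = sym (⁻¹-unique (x ⁻¹) x (⁻¹-inverseˡ x x≢0))

  ⁻¹-distrib-* : ∀ x y → (x * y) ⁻¹ ≡ x ⁻¹ * y ⁻¹
  ⁻¹-distrib-* x y with x ≟ 0# | y ≟ 0#
  ... | yes refl | _ = trans (cong _⁻¹ (zeroˡ y)) (trans ⁻¹-zero (sym (trans (cong (_* y ⁻¹) ⁻¹-zero) (zeroˡ _))))
  ... | no _ | yes refl = trans (cong _⁻¹ (zeroʳ x)) (trans ⁻¹-zero (sym (trans (cong (x ⁻¹ *_) ⁻¹-zero) (zeroʳ _))))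
  ... | no x≢0 | no y≢0 = sym (⁻¹-unique (x * y) (x ⁻¹ * y ⁻¹) (begin
    (x * y) * (x ⁻¹ * y ⁻¹)   ≡⟨ interchange x y (x ⁻¹) (y ⁻¹) ⟩
    (x * x ⁻¹) * (y * y ⁻¹)   ≡⟨ cong₂ _*_ (⁻¹-inverseʳ x x≢0) (⁻¹-inverseʳ y y≢0) ⟩
    1# * 1#                   ≡⟨ *-identityˡ 1# ⟩
    1#                        ∎))

  -1≢0 : -1# ≢ 0#
  -1≢0 -1≡0 = 1≢0 (trans (sym -1*-1≡1) (trans (cong (_* -1#) -1≡0) (zeroˡ -1#)))

  1+x≡0⇒x≡-1 : ∀ x → 1# + x ≡ 0# → x ≡ -1#
  1+x≡0⇒x≡-1 x e = +-inverseˡ-unique x 1# (trans (+-comm x 1#) e)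

  x*c≡x⇒x≡0 : ∀ x c → x * c ≡ x → c ≢ 1# → x ≡ 0#
  x*c≡x⇒x≡0 x c xc≡x c≢1 with x*y≡0⇒x≡0∨y≡0 x (c + - 1#) x[c-1]≡0
    where
    x[c-1]≡0 : x * (c + - 1#) ≡ 0#
    x[c-1]≡0 = begin
      x * (c + - 1#)      ≡⟨ distribˡ x c _ ⟩
      x * c + x * (- 1#)  ≡⟨ cong₂ _+_ xc≡x (sym (-‿distribʳ-* x 1#)) ⟩
      x + - (x * 1#)      ≡⟨ cong (λ z → x + - z) (*-identityʳ x) ⟩
      x + - x             ≡⟨ -‿inverseʳ x ⟩
      0#                  ∎
  ... | inj₁ x≡0   = x≡0
  ... | inj₂ c-1≡0 = ⊥-elim (c≢1 (trans (+-inverseˡ-unique c (- 1#) c-1≡0) (-‿involutive 1#)))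

module _ (S : Setting) where
  open Setting S
  open Theory S
  module FP = FieldProperties 𝔽
  module KP = FieldProperties 𝕂
  open KP using (_+_; _*_; -_; 0#; 1#; _⁻¹; -1#)
  open KP.Solver using (solve; _:=_; _:+_; _:*_; con)
  open ≡-Reasoning

  𝟙[_] : ∀ {p} {P : Set p} → Dec P → K.Carrier
  𝟙[ d ] = if does d then 1# else 0#

  𝟙≡0 : ∀ {P : Set} (d : Dec P) → ¬ P → 𝟙[ d ] ≡ 0#
  𝟙≡0 (yes p) ¬p = ⊥-elim (¬p p)
  𝟙≡0 (no _)  ¬p = refl

  𝟙-cong : ∀ {P R : Set} (p? : Dec P) (r? : Dec R) → (P → R) → (R → P) → 𝟙[ p? ] ≡ 𝟙[ r? ]
  𝟙-cong (yes _) (yes _)  _ _ = refl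
  𝟙-cong (no _)  (no _)   _ _ = refl
  𝟙-cong (yes p) (no ¬r)  f _ = ⊥-elim (¬r (f p))
  𝟙-cong (no ¬p) (yes r)  _ g = ⊥-elim (¬p (g r))

  sumL-cong : ∀ {A : Set} (l : List A) {f h : A → K.Carrier} → (∀ a → f a ≡ h a) → sumL l f ≡ sumL l h
  sumL-cong []      f≗h = refl
  sumL-cong (a ∷ l) f≗h = cong₂ _+_ (f≗h a) (sumL-cong l f≗h)

  sumL-congᴬ : ∀ {A : Set} {P : A → Set} {l : List A} {f h : A → K.Carrier} →
               All P l → (∀ a → P a → f a ≡ h a) → sumL l f ≡ sumL l h
  sumL-congᴬ []                  f≗h = refl
  sumL-congᴬ {l = a ∷ _} (pa ∷ pl) f≗h = cong₂ _+_ (f≗h a pa) (sumL-congᴬ pl f≗h)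

  sumL-0 : ∀ {A : Set} (l : List A) → sumL l (λ _ → 0#) ≡ 0#
  sumL-0 []      = refl
  sumL-0 (a ∷ l) = trans (cong (0# +_) (sumL-0 l)) (KP.+-identityˡ 0#)

  sumL-1 : ∀ {A : Set} (l : List A) → sumL l (λ _ → 1#) ≡ ι 𝕂 (length l)
  sumL-1 []      = refl
  sumL-1 (a ∷ l) = cong (1# +_) (sumL-1 l)

  sumL-+ : ∀ {A : Set} (l : List A) (f h : A → K.Carrier) →
           sumL l (λ a → f a + h a) ≡ sumL l f + sumL l h
  sumL-+ []      f h = sym (KP.+-identityˡ 0#)
  sumL-+ (a ∷ l) f h = trans (cong ((f a + h a) +_) (sumL-+ l f h))
    (solve 4 (λ x y u v → ((x :+ y) :+ (u :+ v)) := ((x :+ u) :+ (y :+ v))) refl (f a) (h a) (sumL l f) (sumL l h))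

  sumL-*ˡ : ∀ {A : Set} (l : List A) (c : K.Carrier) (f : A → K.Carrier) →
            sumL l (λ a → c * f a) ≡ c * sumL l f
  sumL-*ˡ []      c f = sym (KP.zeroʳ c)
  sumL-*ˡ (a ∷ l) c f = trans (cong (c * f a +_) (sumL-*ˡ l c f)) (sym (KP.distribˡ c (f a) _))

  sumL-*ʳ : ∀ {A : Set} (l : List A) (c : K.Carrier) (f : A → K.Carrier) →
            sumL l (λ a → f a * c) ≡ sumL l f * c
  sumL-*ʳ l c f = trans (sumL-cong l (λ a → KP.*-comm (f a) c)) (trans (sumL-*ˡ l c f) (KP.*-comm c _))

  sumL-map : ∀ {A B : Set} (l : List A) (h : A → B) (f : B → K.Carrier) →
             sumL (map h l) f ≡ sumL l (λ a → f (h a))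
  sumL-map []      h f = refl
  sumL-map (a ∷ l) h f = cong (f (h a) +_) (sumL-map l h f)

  sumL-comm : ∀ {A B : Set} (l : List A) (m : List B) (f : A → B → K.Carrier) →
              sumL l (λ a → sumL m (f a)) ≡ sumL m (λ b → sumL l (λ a → f a b))
  sumL-comm []      m f = sym (sumL-0 m)
  sumL-comm (a ∷ l) m f = trans (cong (sumL m (f a) +_) (sumL-comm l m f)) (sym (sumL-+ m (f a) _))

  module _ {A : Set} {P : A → Set} (P? : Decidable P) where
    sumL-𝟙-none : ∀ {l : List A} (G : A → K.Carrier) → All (λ b → ¬ P b) l →
                  sumL l (λ b → 𝟙[ P? b ] * G b) ≡ 0#
    sumL-𝟙-none G [] = refl
    sumL-𝟙-none {b ∷ l} G (¬pb ∷ ¬pl) with P? b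
    ... | yes pb = ⊥-elim (¬pb pb)
    ... | no _   = trans (cong₂ _+_ (KP.zeroˡ (G b)) (sumL-𝟙-none G ¬pl)) (KP.+-identityˡ 0#)

    sumL-𝟙-unique : ∀ {l : List A} (G : A → K.Carrier) (c : K.Carrier) →
                    AllPairs (λ x y → P x → P y → ⊥) l → Any P l → (∀ b → P b → G b ≡ c) →
                    sumL l (λ b → 𝟙[ P? b ] * G b) ≡ c
    sumL-𝟙-unique {b ∷ l} G c (excl ∷ _) (here pb) G≡c with P? b
    ... | no ¬pb = ⊥-elim (¬pb pb)
    ... | yes _  = begin
      1# * G b + sumL l (λ b → 𝟙[ P? b ] * G b)
        ≡⟨ cong₂ _+_ (KP.*-identityˡ (G b)) (sumL-𝟙-none G (mapAll (λ e → e pb) excl)) ⟩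
      G b + 0#  ≡⟨ KP.+-identityʳ _ ⟩
      G b       ≡⟨ G≡c b pb ⟩
      c         ∎
    sumL-𝟙-unique {b ∷ l} G c (excl ∷ rest) (there any) G≡c with P? b
    ... | yes pb = ⊥-elim (lookupWith (λ e p → e pb p) excl any)
    ... | no _   = trans (cong₂ _+_ (KP.zeroˡ (G b)) (sumL-𝟙-unique G c rest any G≡c)) (KP.+-identityˡ _)

  module _ {A : Set} (R : A → A → Set) (R? : ∀ a b → Dec (R a b))
           (R-sym : ∀ {a b} → R a b → R b a) (R-trans : ∀ {a b c} → R a b → R b c → R a c) where
    private
      exclusive : ∀ {l : List A} (a : A) → AllPairs (λ x y → ¬ R x y) l → AllPairs (λ x y → R a x → R a y → ⊥) l
      exclusive a = mapAllPairs (λ ¬xy ax ay → ¬xy (R-trans (R-sym ax) ay))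

    sumL-reindex : ∀ (l₁ l₂ : List A) → AllPairs (λ x y → ¬ R x y) l₁ → AllPairs (λ x y → ¬ R x y) l₂ →
                   All (λ a → Any (R a) l₂) l₁ → All (λ b → Any (R b) l₁) l₂ →
                   (G : A → K.Carrier) → (∀ a b → R a b → G a ≡ G b) →
                   sumL l₁ G ≡ sumL l₂ G
    sumL-reindex l₁ l₂ d₁ d₂ c₁ c₂ G resp = begin
      sumL l₁ G
        ≡⟨ sumL-congᴬ c₁ (λ a any → sym (sumL-𝟙-unique (R? a) G (G a) (exclusive a d₂) any (λ b r → sym (resp a b r)))) ⟩
      sumL l₁ (λ a → sumL l₂ (λ b → 𝟙[ R? a b ] * G b))
        ≡⟨ sumL-comm l₁ l₂ _ ⟩
      sumL l₂ (λ b → sumL l₁ (λ a → 𝟙[ R? a b ] * G b))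
        ≡⟨ sumL-congᴬ c₂ (λ b any → trans (sumL-cong l₁ (λ a → cong (_* G b) (𝟙-cong (R? a b) (R? b a) R-sym R-sym)))
                                          (sumL-𝟙-unique (R? b) (λ _ → G b) (G b) (exclusive b d₁) any (λ _ _ → refl))) ⟩
      sumL l₂ G ∎

  Σ𝔽 : (F.Carrier → K.Carrier) → K.Carrier
  Σ𝔽 = sumL elems

  Σ𝔽-bijection : (h h⁻ : F.Carrier → F.Carrier) → (∀ y → h (h⁻ y) ≡ y) → (∀ x y → h x ≡ h y → x ≡ y) →
                 (f : F.Carrier → K.Carrier) → Σ𝔽 f ≡ Σ𝔽 (λ x → f (h x))
  Σ𝔽-bijection h h⁻ h∘h⁻ h-inj f = sym (trans (sym (sumL-map elems h f))
    (sumL-reindex _≡_ F._≟_ sym trans (map h elems) elems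
      (AllPairs.map⁺ (mapAllPairs (λ x≢y hx≡hy → x≢y (h-inj _ _ hx≡hy)) elems-unique)) elems-unique
      (All.map⁺ (tabulate (λ {x} _ → elems-complete (h x))))
      (tabulate (λ {y} _ → Any.map⁺ (mapAny (λ e → trans (sym (h∘h⁻ y)) (cong h e)) (elems-complete (h⁻ y)))))
      f (λ _ _ → cong f)))

  Σ𝔽-neg : (f : F.Carrier → K.Carrier) → Σ𝔽 f ≡ Σ𝔽 (λ x → f (F.- x))
  Σ𝔽-neg = Σ𝔽-bijection F.-_ F.-_ FP.-‿involutive (λ x y → FP.-‿injective)

  Σ𝔽-scale : (a : F.Carrier) → a ≢ F.0# → (f : F.Carrier → K.Carrier) → Σ𝔽 f ≡ Σ𝔽 (λ x → f (a F.* x))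
  Σ𝔽-scale a a≢0 = Σ𝔽-bijection (a F.*_) (a F.⁻¹ F.*_) (λ y → FP.x*x⁻¹*y≡y a y a≢0)
    (λ x y ax≡ay → trans (FP.*-cancelˡ-⁻¹ a x _ a≢0 ax≡ay) (trans (sym (FP.*-assoc _ _ _))
      (trans (cong (F._* y) (FP.⁻¹-inverseˡ a a≢0)) (FP.*-identityˡ y))))

  Σ𝔽-shift : (a : F.Carrier) → (f : F.Carrier → K.Carrier) → Σ𝔽 f ≡ Σ𝔽 (λ x → f (x F.+ a))
  Σ𝔽-shift a = Σ𝔽-bijection (F._+ a) (F._+ F.- a)
    (λ y → trans (FP.+-assoc _ _ _) (trans (cong (y F.+_) (FP.-‿inverseˡ a)) (FP.+-identityʳ y)))
    (λ x y → FP.+-cancelʳ a x y)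

  Σ𝔽-𝟙 : ∀ (c : F.Carrier) (G : F.Carrier → K.Carrier) → Σ𝔽 (λ x → 𝟙[ x F.≟ c ] * G x) ≡ G c
  Σ𝔽-𝟙 c G = sumL-𝟙-unique (F._≟ c) G (G c) (mapAllPairs (λ x≢y x≡c y≡c → x≢y (trans x≡c (sym y≡c))) elems-unique)
    (mapAny sym (elems-complete c)) (λ _ → cong G)

  -- Characters and Gauss sums

  IsChar : Ch → Set
  IsChar = IsMChar 𝔽 𝕂

  _≈ᶜ_ : Ch → Ch → Set
  _≈ᶜ_ = _≗ᶜ_ 𝔽 𝕂

  ≈ᶜ-sym : ∀ {χ μ} → χ ≈ᶜ μ → μ ≈ᶜ χ
  ≈ᶜ-sym e x = sym (e x)

  ≈ᶜ-trans : ∀ {χ μ ν} → χ ≈ᶜ μ → μ ≈ᶜ ν → χ ≈ᶜ ν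
  ≈ᶜ-trans e f x = trans (e x) (f x)

  _≈ᶜ?_ : ∀ χ μ → Dec (χ ≈ᶜ μ)
  χ ≈ᶜ? μ = map′ (λ all x → lookup all (elems-complete x)) (λ e → tabulate (λ {x} _ → e x))
                 (all? (λ x → χ x K.≟ μ x) elems)

  ε-≢0 : ∀ x → x ≢ F.0# → ε x ≡ 1#
  ε-≢0 x x≢0 with x F.≟ F.0#
  ... | yes x≡0 = ⊥-elim (x≢0 x≡0)
  ... | no _    = refl

  ε-isChar : IsChar ε
  ε-isChar = record { at-0 = ε-0 ; at-1 = ε-≢0 F.1# FP.1≢0 ; mult = ε-mult }
    where
    ε-0 : ε F.0# ≡ 0#
    ε-0 with F.0# F.≟ F.0#
    ... | yes _  = refl
    ... | no 0≢0 = ⊥-elim (0≢0 refl)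
    ε-mult : ∀ x y → ε (x F.* y) ≡ ε x * ε y
    ε-mult x y with x F.≟ F.0# | y F.≟ F.0# | (x F.* y) F.≟ F.0#
    ... | yes _    | _        | yes _ = sym (KP.zeroˡ _)
    ... | no _     | yes _    | yes _ = sym (KP.zeroʳ _)
    ... | no x≢0   | no y≢0   | yes xy≡0 = ⊥-elim (FP.*-≢0 x≢0 y≢0 xy≡0)
    ... | yes refl | _        | no xy≢0 = ⊥-elim (xy≢0 (FP.zeroˡ y))
    ... | no _     | yes refl | no xy≢0 = ⊥-elim (xy≢0 (FP.zeroʳ x))
    ... | no _     | no _     | no _ = sym (KP.*-identityˡ 1#)

  ε-0 : ε F.0# ≡ 0#
  ε-0 = IsMChar.at-0 ε-isChar

  ε-⁻¹ : ∀ x → (ε x) ⁻¹ ≡ ε x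
  ε-⁻¹ x with x F.≟ F.0#
  ... | yes _ = K.⁻¹-zero
  ... | no _  = KP.1⁻¹≡1

  ·-isChar : ∀ {χ μ} → IsChar χ → IsChar μ → IsChar (χ · μ)
  ·-isChar {χ} {μ} χc μc = record
    { at-0 = trans (cong (_* μ F.0#) (IsMChar.at-0 χc)) (KP.zeroˡ _)
    ; at-1 = trans (cong₂ _*_ (IsMChar.at-1 χc) (IsMChar.at-1 μc)) (KP.*-identityˡ 1#)
    ; mult = λ x y → trans (cong₂ _*_ (IsMChar.mult χc x y) (IsMChar.mult μc x y)) (KP.interchange (χ x) (χ y) (μ x) (μ y))
    }

  bar-isChar : ∀ {χ} → IsChar χ → IsChar (bar χ)
  bar-isChar χc = record
    { at-0 = trans (cong _⁻¹ (IsMChar.at-0 χc)) K.⁻¹-zero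
    ; at-1 = trans (cong _⁻¹ (IsMChar.at-1 χc)) KP.1⁻¹≡1
    ; mult = λ x y → trans (cong _⁻¹ (IsMChar.mult χc x y)) (KP.⁻¹-distrib-* _ _)
    }

  prodCh-isChar : ∀ {m} (v : Fin m → Ch) → (∀ j → IsChar (v j)) → IsChar (prodCh v)
  prodCh-isChar {zero}  v vc = ε-isChar
  prodCh-isChar {suc m} v vc = ·-isChar (vc zero) (prodCh-isChar (λ j → v (suc j)) (λ j → vc (suc j)))

  module _ {χ : Ch} (χc : IsChar χ) where
    open IsMChar χc

    char-≢0 : ∀ x → x ≢ F.0# → χ x ≢ 0#
    char-≢0 x x≢0 χx≡0 = KP.0≢1 (begin
      0#                      ≡⟨ sym (KP.zeroˡ _) ⟩
      0# * χ (x F.⁻¹)         ≡⟨ cong (_* χ (x F.⁻¹)) (sym χx≡0) ⟩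
      χ x * χ (x F.⁻¹)        ≡⟨ sym (mult x _) ⟩
      χ (x F.* x F.⁻¹)        ≡⟨ cong χ (FP.⁻¹-inverseʳ x x≢0) ⟩
      χ F.1#                  ≡⟨ at-1 ⟩
      1#                      ∎)

    char[-1]²≡1 : χ FP.-1# * χ FP.-1# ≡ 1#
    char[-1]²≡1 = trans (sym (mult _ _)) (trans (cong χ FP.-1*-1≡1) at-1)

    char[-1]⁻¹ : (χ FP.-1#) ⁻¹ ≡ χ FP.-1#
    char[-1]⁻¹ = sym (KP.⁻¹-unique (χ FP.-1#) (χ FP.-1#) char[-1]²≡1)

    char·bar≈ε : (χ · bar χ) ≈ᶜ ε
    char·bar≈ε x with x F.≟ F.0#
    ... | yes refl = trans (cong (_* (χ F.0#) ⁻¹) at-0) (KP.zeroˡ _)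
    ... | no x≢0   = KP.⁻¹-inverseʳ _ (char-≢0 x x≢0)

    char·ε≈char : (χ · ε) ≈ᶜ χ
    char·ε≈char x with x F.≟ F.0#
    ... | yes refl = trans (KP.zeroʳ _) (sym at-0)
    ... | no x≢0   = KP.*-identityʳ _

    nontrivial-witness : ¬ χ ≈ᶜ ε → ∃ λ x → x ≢ F.0# × χ x ≢ 1#
    nontrivial-witness χ≉ε with any? (λ x → ¬? (χ x K.≟ ε x)) elems
    ... | no none = ⊥-elim (χ≉ε (λ x → decidable-stable (χ x K.≟ ε x) (λ ne → none (mapAny (λ { refl → ne }) (elems-complete x)))))
    ... | yes some with satisfied some
    ...   | x , χx≢εx with x F.≟ F.0#
    ...     | yes refl = ⊥-elim (χx≢εx at-0)
    ...     | no x≢0   = x , x≢0 , χx≢εx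

  isTrivial-sound : ∀ {χ} → IsChar χ → isTrivial χ ≡ true → χ ≈ᶜ ε
  isTrivial-sound {χ} χc triv x = pointwise (lookup (all⁺ _ elems (Equivalence.from T-≡ triv)) (elems-complete x))
    where
    pointwise : T (does (x F.≟ F.0#) ∨ does (χ x K.≟ ε x)) → χ x ≡ ε x
    pointwise t with x F.≟ F.0# | χ x K.≟ ε x
    ... | _        | yes χx≡εx = χx≡εx
    ... | yes refl | no _      = IsMChar.at-0 χc
    ... | no _     | no _      = ⊥-elim t

  isTrivial-complete : ∀ {χ} → χ ≈ᶜ ε → isTrivial χ ≡ true
  isTrivial-complete {χ} χ≈ε = Equivalence.to T-≡ (all⁻ _ {elems} (tabulate (λ {x} _ → pointwise x)))
    where
    pointwise : ∀ x → T (does (x F.≟ F.0#) ∨ does (χ x K.≟ ε x))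
    pointwise x with χ x K.≟ ε x
    ... | yes _ = Equivalence.from (T-∨ {does (x F.≟ F.0#)}) (inj₂ _)
    ... | no ne = ⊥-elim (ne (χ≈ε x))

  isTrivial-false : ∀ {χ} → IsChar χ → ¬ χ ≈ᶜ ε → isTrivial χ ≡ false
  isTrivial-false {χ} χc χ≉ε with isTrivial χ in triv
  ... | true  = ⊥-elim (χ≉ε (isTrivial-sound χc triv))
  ... | false = refl

  isTrivial-cong : ∀ {χ μ} → χ ≈ᶜ μ → isTrivial χ ≡ isTrivial μ
  isTrivial-cong χ≈μ = cong and (map-cong (λ x → cong (λ z → does (x F.≟ F.0#) ∨ does (z K.≟ ε x)) (χ≈μ x)) elems)

  g-cong : ∀ {χ μ} → χ ≈ᶜ μ → g χ ≡ g μ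
  g-cong χ≈μ = cong -_ (sumL-cong units (λ x → cong (ψ x *_) (χ≈μ x)))

  g°-cong : ∀ {χ μ} → χ ≈ᶜ μ → g° χ ≡ g° μ
  g°-cong χ≈μ rewrite isTrivial-cong χ≈μ | g-cong χ≈μ = refl

  g°-trivial : ∀ {η} → η ≈ᶜ ε → g° η ≡ ι 𝕂 q * g η
  g°-trivial η≈ε rewrite isTrivial-complete η≈ε = refl

  g°-nontrivial : ∀ {η} → IsChar η → ¬ η ≈ᶜ ε → g° η ≡ g η
  g°-nontrivial ηc η≉ε rewrite isTrivial-false ηc η≉ε = refl

  sum-units : ∀ (f : F.Carrier → K.Carrier) → f F.0# ≡ 0# → sumL units f ≡ Σ𝔽 f
  sum-units f f0≡0 = go elems
    where
    go : ∀ l → sumL (filter (λ x → ¬? (x F.≟ F.0#)) l) f ≡ sumL l f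
    go []      = refl
    go (x ∷ l) with x F.≟ F.0#
    ... | yes refl = trans (go l) (sym (trans (cong (_+ sumL l f) f0≡0) (KP.+-identityˡ _)))
    ... | no _     = cong (f x +_) (go l)

  private
    nonempty : ∀ {A : Set} {P : A → Set} {l : List A} → Any P l → ∃ λ k → length l ≡ suc k
    nonempty {l = _ ∷ l} _ = length l , refl

  Q : K.Carrier
  Q = ι 𝕂 (length chars)

  ι-q≡1+Q : ι 𝕂 q ≡ 1# + Q
  ι-q≡1+Q with nonempty (elems-complete F.0#)
  ... | k , q≡1+k = trans (cong (ι 𝕂) q≡1+k) (cong (λ z → 1# + ι 𝕂 z) (sym (trans chars-count (cong (_∸ 1) q≡1+k))))

  ι-q≢0 : ι 𝕂 q ≢ 0#
  ι-q≢0 with nonempty (elems-complete F.0#)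
  ... | k , q≡1+k = λ ι-q≡0 → char0 k (trans (cong (ι 𝕂) (sym q≡1+k)) ι-q≡0)

  Q≢0 : Q ≢ 0#
  Q≢0 with nonempty (chars-complete ε ε-isChar)
  ... | k , Q≡1+k = λ Q≡0 → char0 k (trans (cong (ι 𝕂) (sym Q≡1+k)) Q≡0)

  Σ𝔽-puncture : ∀ c (f w : F.Carrier → K.Carrier) → w c ≡ 0# → (∀ x → x ≢ c → w x ≡ 1#) →
                Σ𝔽 (λ x → f x * w x) + f c ≡ Σ𝔽 f
  Σ𝔽-puncture c f w wc≡0 w≡1 = begin
    Σ𝔽 (λ x → f x * w x) + f c                              ≡⟨ cong (_ +_) (sym (Σ𝔽-𝟙 c f)) ⟩
    Σ𝔽 (λ x → f x * w x) + Σ𝔽 (λ x → 𝟙[ x F.≟ c ] * f x)    ≡⟨ sym (sumL-+ elems _ _) ⟩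
    Σ𝔽 (λ x → f x * w x + 𝟙[ x F.≟ c ] * f x)               ≡⟨ sumL-cong elems pointwise ⟩
    Σ𝔽 f                                                     ∎
    where
    pointwise : ∀ x → f x * w x + 𝟙[ x F.≟ c ] * f x ≡ f x
    pointwise x with x F.≟ c
    ... | yes refl = trans (cong₂ _+_ (trans (cong (f x *_) wc≡0) (KP.zeroʳ _)) (KP.*-identityˡ _)) (KP.+-identityˡ _)
    ... | no x≢c   = trans (cong₂ _+_ (trans (cong (f x *_) (w≡1 x x≢c)) (KP.*-identityʳ _)) (KP.zeroˡ _)) (KP.+-identityʳ _)

  Σ𝔽-ε : Σ𝔽 ε ≡ Q
  Σ𝔽-ε = KP.+-cancelʳ 1# _ _ (begin
    Σ𝔽 ε + 1#                     ≡⟨ cong (_+ 1#) (sumL-cong elems (λ x → sym (KP.*-identityˡ (ε x)))) ⟩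
    Σ𝔽 (λ x → 1# * ε x) + 1#      ≡⟨ Σ𝔽-puncture F.0# (λ _ → 1#) ε ε-0 ε-≢0 ⟩
    Σ𝔽 (λ _ → 1#)                 ≡⟨ sumL-1 elems ⟩
    ι 𝕂 q                         ≡⟨ ι-q≡1+Q ⟩
    1# + Q                        ≡⟨ KP.+-comm 1# Q ⟩
    Q + 1#                        ∎)

  Σ𝔽-char-trivial : ∀ {χ} → χ ≈ᶜ ε → Σ𝔽 χ ≡ Q
  Σ𝔽-char-trivial χ≈ε = trans (sumL-cong elems χ≈ε) Σ𝔽-ε

  -- a sum invariant under multiplication by a factor ≠ 1 vanishes
  Σ𝔽-char-nontrivial : ∀ {χ} → IsChar χ → ¬ χ ≈ᶜ ε → Σ𝔽 χ ≡ 0#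
  Σ𝔽-char-nontrivial {χ} χc χ≉ε with nontrivial-witness χc χ≉ε
  ... | a , a≢0 , χa≢1 = KP.x*c≡x⇒x≡0 (Σ𝔽 χ) (χ a) (sym (begin
      Σ𝔽 χ                     ≡⟨ Σ𝔽-scale a a≢0 χ ⟩
      Σ𝔽 (λ y → χ (a F.* y))   ≡⟨ sumL-cong elems (λ y → trans (IsMChar.mult χc a y) (KP.*-comm _ _)) ⟩
      Σ𝔽 (λ y → χ y * χ a)     ≡⟨ sumL-*ʳ elems (χ a) χ ⟩
      Σ𝔽 χ * χ a               ∎)) χa≢1

  Σ𝔽-char : ∀ {χ} → IsChar χ → Σ𝔽 χ ≡ 𝟙[ χ ≈ᶜ? ε ] * Q
  Σ𝔽-char {χ} χc = by-cases (χ ≈ᶜ? ε)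
    where
    by-cases : (d : Dec (χ ≈ᶜ ε)) → Σ𝔽 χ ≡ 𝟙[ d ] * Q
    by-cases (yes χ≈ε) = trans (Σ𝔽-char-trivial χ≈ε) (sym (KP.*-identityˡ Q))
    by-cases (no χ≉ε)  = trans (Σ𝔽-char-nontrivial χc χ≉ε) (sym (KP.zeroˡ Q))

  Σ𝔽-ψ : Σ𝔽 ψ ≡ 0#
  Σ𝔽-ψ with ψ-nontrivial
  ... | a , ψa≢1 = KP.x*c≡x⇒x≡0 (Σ𝔽 ψ) (ψ a) (sym (begin
      Σ𝔽 ψ                     ≡⟨ Σ𝔽-shift a ψ ⟩
      Σ𝔽 (λ x → ψ (x F.+ a))   ≡⟨ sumL-cong elems (λ x → ψ-add x a) ⟩
      Σ𝔽 (λ x → ψ x * ψ a)     ≡⟨ sumL-*ʳ elems (ψ a) ψ ⟩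
      Σ𝔽 ψ * ψ a               ∎)) ψa≢1

  ψχ : Ch → F.Carrier → K.Carrier
  ψχ χ x = ψ x * χ x

  g≡-Σ𝔽ψχ : ∀ {χ} → IsChar χ → g χ ≡ - Σ𝔽 (ψχ χ)
  g≡-Σ𝔽ψχ χc = cong -_ (sum-units _ (trans (cong (ψ F.0# *_) (IsMChar.at-0 χc)) (KP.zeroʳ _)))

  Σ𝔽ψχ≡-g : ∀ {χ} → IsChar χ → Σ𝔽 (ψχ χ) ≡ - g χ
  Σ𝔽ψχ≡-g χc = sym (trans (cong -_ (g≡-Σ𝔽ψχ χc)) (KP.-‿involutive _))

  g-ε : g ε ≡ 1#
  g-ε = begin
    g ε               ≡⟨ g≡-Σ𝔽ψχ ε-isChar ⟩
    - Σ𝔽 (ψχ ε)       ≡⟨ cong -_ (KP.+-inverseˡ-unique _ _ Σ𝔽ψχε+1≡0) ⟩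
    - - 1#            ≡⟨ KP.-‿involutive 1# ⟩
    1#                ∎
    where
    Σ𝔽ψχε+1≡0 : Σ𝔽 (ψχ ε) + 1# ≡ 0#
    Σ𝔽ψχε+1≡0 = trans (cong (Σ𝔽 (ψχ ε) +_) (sym ψ-zero)) (trans (Σ𝔽-puncture F.0# ψ ε ε-0 ε-≢0) Σ𝔽-ψ)

  twistedGauss : Ch → F.Carrier → K.Carrier
  twistedGauss χ c = Σ𝔽 (λ y → ψ (y F.* c) * χ y)

  twistedGauss-≢0 : ∀ {χ} → IsChar χ → ∀ c → c ≢ F.0# → twistedGauss χ c ≡ χ (c F.⁻¹) * (- g χ)
  twistedGauss-≢0 {χ} χc c c≢0 = begin
    twistedGauss χ c                                              ≡⟨ Σ𝔽-scale (c F.⁻¹) (FP.⁻¹-≢0 c c≢0) _ ⟩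
    Σ𝔽 (λ y → ψ ((c F.⁻¹ F.* y) F.* c) * χ (c F.⁻¹ F.* y))        ≡⟨ sumL-cong elems pointwise ⟩
    Σ𝔽 (λ y → χ (c F.⁻¹) * ψχ χ y)                                ≡⟨ sumL-*ˡ elems _ _ ⟩
    χ (c F.⁻¹) * Σ𝔽 (ψχ χ)                                        ≡⟨ cong (χ (c F.⁻¹) *_) (Σ𝔽ψχ≡-g χc) ⟩
    χ (c F.⁻¹) * (- g χ)                                          ∎
    where
    pointwise : ∀ y → ψ ((c F.⁻¹ F.* y) F.* c) * χ (c F.⁻¹ F.* y) ≡ χ (c F.⁻¹) * ψχ χ y
    pointwise y = trans (cong₂ _*_ (cong ψ (trans (FP.*-comm _ c) (FP.x*x⁻¹*y≡y c y c≢0))) (IsMChar.mult χc _ y))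
                        (KP.x∙yz≈y∙xz (ψ y) (χ (c F.⁻¹)) (χ y))

  twistedGauss-0 : ∀ χ → twistedGauss χ F.0# ≡ Σ𝔽 χ
  twistedGauss-0 χ = sumL-cong elems (λ y →
    trans (cong (λ z → ψ z * χ y) (FP.zeroʳ y)) (trans (cong (_* χ y) ψ-zero) (KP.*-identityˡ _)))

  jacobi : Ch → Ch → K.Carrier
  jacobi a b = Σ𝔽 (λ s → a s * (a · b) ((F.1# F.+ s) F.⁻¹))

  module _ {a b : Ch} (ac : IsChar a) (bc : IsChar b) where
    private
      ab = a · b
      abc = ·-isChar ac bc

    ΣΣψχ-substitute : ∀ y → Σ𝔽 (λ x → ψχ a x * ψχ b y) ≡ Σ𝔽 (λ s → ψ (y F.* (F.1# F.+ s)) * (a s * ab y))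
    ΣΣψχ-substitute y with y F.≟ F.0#
    ... | yes refl = trans (sumL-cong elems (λ x → trans (cong (λ z → ψχ a x * (ψ F.0# * z)) (IsMChar.at-0 bc))
                                                  (trans (cong (ψχ a x *_) (KP.zeroʳ _)) (KP.zeroʳ _))))
                     (trans (sumL-0 elems) (sym (trans (sumL-cong elems (λ s →
                       trans (cong (λ z → ψ (F.0# F.* (F.1# F.+ s)) * (a s * z)) (IsMChar.at-0 abc))
                             (trans (cong (_ *_) (KP.zeroʳ _)) (KP.zeroʳ _)))) (sumL-0 elems))))
    ... | no y≢0 = trans (Σ𝔽-scale y y≢0 _) (sumL-cong elems pointwise)
      where
      pointwise : ∀ s → ψχ a (y F.* s) * ψχ b y ≡ ψ (y F.* (F.1# F.+ s)) * (a s * ab y)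
      pointwise s = begin
        (ψ (y F.* s) * a (y F.* s)) * (ψ y * b y)
          ≡⟨ cong (λ z → (ψ (y F.* s) * z) * (ψ y * b y)) (IsMChar.mult ac y s) ⟩
        (ψ (y F.* s) * (a y * a s)) * (ψ y * b y)
          ≡⟨ solve 5 (λ P A S′ Py B → ((P :* (A :* S′)) :* (Py :* B)) := ((P :* Py) :* (S′ :* (A :* B)))) refl
                   (ψ (y F.* s)) (a y) (a s) (ψ y) (b y) ⟩
        (ψ (y F.* s) * ψ y) * (a s * ab y)
          ≡⟨ cong (_* (a s * ab y)) (sym (trans (cong ψ y[1+s]≡ys+y) (ψ-add _ _))) ⟩
        ψ (y F.* (F.1# F.+ s)) * (a s * ab y) ∎
        where
        y[1+s]≡ys+y : y F.* (F.1# F.+ s) ≡ y F.* s F.+ y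
        y[1+s]≡ys+y = trans (FP.distribˡ y F.1# s) (trans (cong (F._+ (y F.* s)) (FP.*-identityʳ y)) (FP.+-comm _ _))

    g*g≡Σ-twistedGauss : g a * g b ≡ Σ𝔽 (λ s → a s * twistedGauss ab (F.1# F.+ s))
    g*g≡Σ-twistedGauss = begin
      g a * g b
        ≡⟨ cong₂ _*_ (g≡-Σ𝔽ψχ ac) (g≡-Σ𝔽ψχ bc) ⟩
      (- Σ𝔽 (ψχ a)) * (- Σ𝔽 (ψχ b))
        ≡⟨ KP.-x*-y≡x*y _ _ ⟩
      Σ𝔽 (ψχ a) * Σ𝔽 (ψχ b)
        ≡⟨ sym (sumL-*ˡ elems _ (ψχ b)) ⟩
      Σ𝔽 (λ y → Σ𝔽 (ψχ a) * ψχ b y)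
        ≡⟨ sumL-cong elems (λ y → trans (sym (sumL-*ʳ elems (ψχ b y) (ψχ a))) (ΣΣψχ-substitute y)) ⟩
      Σ𝔽 (λ y → Σ𝔽 (λ s → ψ (y F.* (F.1# F.+ s)) * (a s * ab y)))
        ≡⟨ sumL-comm elems elems _ ⟩
      Σ𝔽 (λ s → Σ𝔽 (λ y → ψ (y F.* (F.1# F.+ s)) * (a s * ab y)))
        ≡⟨ sumL-cong elems (λ s → trans (sumL-cong elems (λ y → KP.x∙yz≈y∙xz _ (a s) (ab y))) (sumL-*ˡ elems (a s) _)) ⟩
      Σ𝔽 (λ s → a s * twistedGauss ab (F.1# F.+ s)) ∎

    twistedGauss-at-1+ : ∀ s → a s * twistedGauss ab (F.1# F.+ s)
                             ≡ (- g ab) * (a s * ab ((F.1# F.+ s) F.⁻¹)) + 𝟙[ s F.≟ FP.-1# ] * (a FP.-1# * Σ𝔽 ab)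
    twistedGauss-at-1+ s with s F.≟ FP.-1#
    ... | yes refl = begin
      a FP.-1# * twistedGauss ab (F.1# F.+ FP.-1#)
        ≡⟨ cong (λ z → a FP.-1# * twistedGauss ab z) (FP.-‿inverseʳ F.1#) ⟩
      a FP.-1# * twistedGauss ab F.0#
        ≡⟨ cong (a FP.-1# *_) (twistedGauss-0 ab) ⟩
      a FP.-1# * Σ𝔽 ab
        ≡⟨ sym (trans (cong₂ _+_ J-term≡0 (KP.*-identityˡ _)) (KP.+-identityˡ _)) ⟩
      (- g ab) * (a FP.-1# * ab ((F.1# F.+ FP.-1#) F.⁻¹)) + 1# * (a FP.-1# * Σ𝔽 ab) ∎
      where
      J-term≡0 : (- g ab) * (a FP.-1# * ab ((F.1# F.+ FP.-1#) F.⁻¹)) ≡ 0#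
      J-term≡0 = trans (cong (λ z → (- g ab) * (a FP.-1# * ab z)) (trans (cong F._⁻¹ (FP.-‿inverseʳ F.1#)) F.⁻¹-zero))
                   (trans (cong (λ z → (- g ab) * (a FP.-1# * z)) (IsMChar.at-0 abc))
                     (trans (cong ((- g ab) *_) (KP.zeroʳ _)) (KP.zeroʳ _)))
    ... | no s≢-1 = begin
      a s * twistedGauss ab (F.1# F.+ s)
        ≡⟨ cong (a s *_) (twistedGauss-≢0 abc (F.1# F.+ s) (λ e → s≢-1 (FP.1+x≡0⇒x≡-1 s e))) ⟩
      a s * (ab ((F.1# F.+ s) F.⁻¹) * (- g ab))
        ≡⟨ KP.x∙yz≈z∙xy (a s) _ _ ⟩
      (- g ab) * (a s * ab ((F.1# F.+ s) F.⁻¹))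
        ≡⟨ sym (trans (cong ((- g ab) * (a s * ab ((F.1# F.+ s) F.⁻¹)) +_) (KP.zeroˡ _)) (KP.+-identityʳ _)) ⟩
      (- g ab) * (a s * ab ((F.1# F.+ s) F.⁻¹)) + 0# * (a FP.-1# * Σ𝔽 ab) ∎

    g*g≡jacobi : g a * g b ≡ (- g ab) * jacobi a b + a FP.-1# * Σ𝔽 ab
    g*g≡jacobi = begin
      g a * g b
        ≡⟨ g*g≡Σ-twistedGauss ⟩
      Σ𝔽 (λ s → a s * twistedGauss ab (F.1# F.+ s))
        ≡⟨ sumL-cong elems twistedGauss-at-1+ ⟩
      Σ𝔽 (λ s → (- g ab) * (a s * ab ((F.1# F.+ s) F.⁻¹)) + 𝟙[ s F.≟ FP.-1# ] * (a FP.-1# * Σ𝔽 ab))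
        ≡⟨ sumL-+ elems _ _ ⟩
      Σ𝔽 (λ s → (- g ab) * (a s * ab ((F.1# F.+ s) F.⁻¹))) + Σ𝔽 (λ s → 𝟙[ s F.≟ FP.-1# ] * (a FP.-1# * Σ𝔽 ab))
        ≡⟨ cong₂ _+_ (sumL-*ˡ elems _ _) (Σ𝔽-𝟙 FP.-1# (λ _ → a FP.-1# * Σ𝔽 ab)) ⟩
      (- g ab) * jacobi a b + a FP.-1# * Σ𝔽 ab ∎

  g°-reflection : ∀ {η} → IsChar η → g° η * g (bar η) ≡ η FP.-1# * ι 𝕂 q
  g°-reflection {η} ηc = by-cases (η ≈ᶜ? ε)
    where
    ηη̄≈ε = char·bar≈ε ηc

    jacobi-η-η̄ : ¬ η ≈ᶜ ε → jacobi η (bar η) ≡ - η FP.-1#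
    jacobi-η-η̄ η≉ε = KP.+-inverseˡ-unique _ _ (begin
      jacobi η (bar η) + η FP.-1#
        ≡⟨ cong (_+ η FP.-1#) (sumL-cong elems (λ s → cong (η s *_) (ηη̄≈ε _))) ⟩
      Σ𝔽 (λ s → η s * ε ((F.1# F.+ s) F.⁻¹)) + η FP.-1#
        ≡⟨ Σ𝔽-puncture FP.-1# η (λ s → ε ((F.1# F.+ s) F.⁻¹)) ε[0⁻¹]≡0
             (λ s s≢-1 → ε-≢0 _ (FP.⁻¹-≢0 _ (λ e → s≢-1 (FP.1+x≡0⇒x≡-1 s e)))) ⟩
      Σ𝔽 η
        ≡⟨ Σ𝔽-char-nontrivial ηc η≉ε ⟩
      0# ∎)
      where
      ε[0⁻¹]≡0 : ε ((F.1# F.+ FP.-1#) F.⁻¹) ≡ 0#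
      ε[0⁻¹]≡0 = trans (cong (λ z → ε (z F.⁻¹)) (FP.-‿inverseʳ F.1#)) (trans (cong ε F.⁻¹-zero) ε-0)

    by-cases : Dec (η ≈ᶜ ε) → g° η * g (bar η) ≡ η FP.-1# * ι 𝕂 q
    by-cases (yes η≈ε) = begin
      g° η * g (bar η)        ≡⟨ cong₂ _*_ (g°-trivial η≈ε) (g-cong η̄≈ε) ⟩
      (ι 𝕂 q * g η) * g ε     ≡⟨ cong₂ (λ u v → (ι 𝕂 q * u) * v) (trans (g-cong η≈ε) g-ε) g-ε ⟩
      (ι 𝕂 q * 1#) * 1#       ≡⟨ solve 1 (λ x → ((x :* con 1) :* con 1) := (con 1 :* x)) refl (ι 𝕂 q) ⟩
      1# * ι 𝕂 q              ≡⟨ cong (_* ι 𝕂 q) (sym (trans (η≈ε FP.-1#) (ε-≢0 _ FP.-1≢0))) ⟩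
      η FP.-1# * ι 𝕂 q        ∎
      where
      η̄≈ε : bar η ≈ᶜ ε
      η̄≈ε x = trans (cong _⁻¹ (η≈ε x)) (ε-⁻¹ x)
    by-cases (no η≉ε) = begin
      g° η * g (bar η)
        ≡⟨ cong (_* g (bar η)) (g°-nontrivial ηc η≉ε) ⟩
      g η * g (bar η)
        ≡⟨ g*g≡jacobi ηc (bar-isChar ηc) ⟩
      (- g (η · bar η)) * jacobi η (bar η) + η FP.-1# * Σ𝔽 (η · bar η)
        ≡⟨ cong₂ (λ u v → (- u) * v + η FP.-1# * Σ𝔽 (η · bar η)) (trans (g-cong ηη̄≈ε) g-ε) (jacobi-η-η̄ η≉ε) ⟩
      (- 1#) * (- η FP.-1#) + η FP.-1# * Σ𝔽 (η · bar η)
        ≡⟨ cong₂ _+_ (trans (KP.-x*-y≡x*y _ _) (KP.*-identityˡ _)) (cong (η FP.-1# *_) (Σ𝔽-char-trivial ηη̄≈ε)) ⟩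
      η FP.-1# + η FP.-1# * Q
        ≡⟨ solve 2 (λ A B → (A :+ A :* B) := (A :* (con 1 :+ B))) refl (η FP.-1#) Q ⟩
      η FP.-1# * (1# + Q)
        ≡⟨ cong (η FP.-1# *_) (sym ι-q≡1+Q) ⟩
      η FP.-1# * ι 𝕂 q ∎

  g°-reflection-≢0 : ∀ {η} → IsChar η → η FP.-1# * ι 𝕂 q ≢ 0#
  g°-reflection-≢0 ηc = KP.*-≢0 (char-≢0 ηc FP.-1# FP.-1≢0) ι-q≢0

  g°-≢0 : ∀ {η} → IsChar η → g° η ≢ 0#
  g°-≢0 {η} ηc g°η≡0 = g°-reflection-≢0 ηc
    (trans (sym (g°-reflection ηc)) (trans (cong (_* g (bar η)) g°η≡0) (KP.zeroˡ _)))

  g-≢0 : ∀ {η} → IsChar η → g η ≢ 0#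
  g-≢0 {η} ηc gη≡0 = g°-reflection-≢0 η̄c (trans (sym (g°-reflection η̄c))
    (trans (cong (g° (bar η) *_) (trans (g-cong (λ x → KP.⁻¹-involutive (η x))) gη≡0)) (KP.zeroʳ _)))
    where
    η̄c = bar-isChar ηc

  g°⁻¹ : ∀ {η} → IsChar η → (g° η) ⁻¹ ≡ g (bar η) * (η FP.-1# * (ι 𝕂 q) ⁻¹)
  g°⁻¹ {η} ηc = begin
    (g° η) ⁻¹
      ≡⟨ KP.*-cancelˡ-⁻¹ (η FP.-1# * ι 𝕂 q) _ _ (g°-reflection-≢0 ηc) (begin
           (η FP.-1# * ι 𝕂 q) * (g° η) ⁻¹          ≡⟨ cong (_* (g° η) ⁻¹) (sym (g°-reflection ηc)) ⟩
           (g° η * g (bar η)) * (g° η) ⁻¹          ≡⟨ solve 3 (λ x y z → ((x :* y) :* z) := (y :* (x :* z))) refl (g° η) _ _ ⟩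
           g (bar η) * (g° η * (g° η) ⁻¹)          ≡⟨ cong (g (bar η) *_) (KP.⁻¹-inverseʳ _ (g°-≢0 ηc)) ⟩
           g (bar η) * 1#                          ≡⟨ KP.*-identityʳ _ ⟩
           g (bar η)                               ∎) ⟩
    (η FP.-1# * ι 𝕂 q) ⁻¹ * g (bar η)
      ≡⟨ KP.*-comm _ _ ⟩
    g (bar η) * (η FP.-1# * ι 𝕂 q) ⁻¹
      ≡⟨ cong (g (bar η) *_) (trans (KP.⁻¹-distrib-* _ _) (cong (_* (ι 𝕂 q) ⁻¹) (char[-1]⁻¹ ηc))) ⟩
    g (bar η) * (η FP.-1# * (ι 𝕂 q) ⁻¹) ∎

  -- Orthogonality of characters

  module _ {μ : Ch} (μc : IsChar μ) where
    private
      μ·-injective : ∀ {a b} → IsChar a → IsChar b → (μ · a) ≈ᶜ (μ · b) → a ≈ᶜ b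
      μ·-injective {a} {b} ac bc μa≈μb x with x F.≟ F.0#
      ... | yes refl = trans (IsMChar.at-0 ac) (sym (IsMChar.at-0 bc))
      ... | no x≢0   = trans (KP.*-cancelˡ-⁻¹ (μ x) (a x) _ (char-≢0 μc x x≢0) (μa≈μb x))
                             (sym (KP.*-cancelˡ-⁻¹ (μ x) (b x) _ (char-≢0 μc x x≢0) refl))

      μ·μ̄·≈id : ∀ {b} → IsChar b → (μ · (bar μ · b)) ≈ᶜ b
      μ·μ̄·≈id {b} bc x with x F.≟ F.0#
      ... | yes refl = trans (cong (_* ((μ F.0#) ⁻¹ * b F.0#)) (IsMChar.at-0 μc)) (trans (KP.zeroˡ _) (sym (IsMChar.at-0 bc)))
      ... | no x≢0   = KP.x*x⁻¹*y≡y (μ x) (b x) (char-≢0 μc x x≢0)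

      μ·-distinct : ∀ (l : List Ch) → All IsChar l → AllPairs (λ x y → ¬ x ≈ᶜ y) l →
                    AllPairs (λ a b → ¬ (μ · a) ≈ᶜ (μ · b)) l
      μ·-distinct []      _          []          = []
      μ·-distinct (x ∷ l) (xc ∷ lc) (x≉l ∷ l≉) = head l lc x≉l ∷ μ·-distinct l lc l≉
        where
        head : ∀ l′ → All IsChar l′ → All (λ y → ¬ x ≈ᶜ y) l′ → All (λ y → ¬ (μ · x) ≈ᶜ (μ · y)) l′
        head []       _           []          = []
        head (y ∷ l′) (yc ∷ l′c) (x≉y ∷ x≉l′) = (λ e → x≉y (μ·-injective xc yc e)) ∷ head l′ l′c x≉l′

    sumChars-translate : ∀ (G : Ch → K.Carrier) → (∀ a b → a ≈ᶜ b → G a ≡ G b) →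
                         sumL chars G ≡ sumL chars (λ ν → G (μ · ν))
    sumChars-translate G G-cong = sym (trans (sym (sumL-map chars (μ ·_) G))
      (sumL-reindex _≈ᶜ_ _≈ᶜ?_ ≈ᶜ-sym ≈ᶜ-trans (map (μ ·_) chars) chars
        (AllPairs.map⁺ (μ·-distinct chars chars-char chars-distinct)) chars-distinct
        (All.map⁺ (mapAll (λ {ν} νc → chars-complete (μ · ν) (·-isChar μc νc)) chars-char))
        (mapAll (λ {b} bc → Any.map⁺ (mapAny (λ {ν} e x → trans (sym (μ·μ̄·≈id bc x)) (cong (μ x *_) (e x)))
                   (chars-complete (bar μ · b) (·-isChar (bar-isChar μc) bc)))) chars-char)
        G G-cong))

  charSum : F.Carrier → K.Carrier
  charSum y = sumL chars (λ ν → ν y)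

  charSum-1 : charSum F.1# ≡ Q
  charSum-1 = trans (sumL-congᴬ chars-char (λ ν νc → IsMChar.at-1 νc)) (sumL-1 chars)

  charSum-invariant : ∀ {μ} → IsChar μ → ∀ y → charSum y * μ y ≡ charSum y
  charSum-invariant {μ} μc y = sym (trans (sumChars-translate μc (λ ν → ν y) (λ a b e → e y))
                                  (trans (sumL-*ˡ chars (μ y) (λ ν → ν y)) (KP.*-comm _ _)))

  charSum-dichotomy : ∀ y → charSum y ≡ 0# ⊎ charSum y ≡ Q
  charSum-dichotomy y with charSum y K.≟ 0#
  ... | yes S≡0 = inj₁ S≡0
  ... | no S≢0  = inj₂ (trans (sumL-congᴬ chars-char all-1) (sumL-1 chars))
    where
    all-1 : ∀ μ → IsChar μ → μ y ≡ 1#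
    all-1 μ μc with μ y K.≟ 1#
    ... | yes μy≡1 = μy≡1
    ... | no μy≢1  = ⊥-elim (S≢0 (KP.x*c≡x⇒x≡0 (charSum y) (μ y) (charSum-invariant μc y) μy≢1))

  Σ𝔽-charSum : Σ𝔽 charSum ≡ Q
  Σ𝔽-charSum = begin
    Σ𝔽 charSum                          ≡⟨ sumL-comm elems chars (λ y ν → ν y) ⟩
    sumL chars Σ𝔽                       ≡⟨ sumL-congᴬ chars-char (λ ν νc → Σ𝔽-char νc) ⟩
    sumL chars (λ ν → 𝟙[ ν ≈ᶜ? ε ] * Q) ≡⟨ sumL-𝟙-unique (_≈ᶜ? ε) (λ _ → Q) Q
                                             (mapAllPairs (λ ν≉μ ν≈ε μ≈ε → ν≉μ (≈ᶜ-trans ν≈ε (≈ᶜ-sym μ≈ε))) chars-distinct)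
                                             (mapAny ≈ᶜ-sym (chars-complete ε ε-isChar)) (λ _ _ → refl) ⟩
    Q                                   ∎

  private
    ι-+ : ∀ a b → ι 𝕂 (a +ℕ b) ≡ ι 𝕂 a + ι 𝕂 b
    ι-+ zero    b = sym (KP.+-identityˡ _)
    ι-+ (suc a) b = trans (cong (1# +_) (ι-+ a b)) (sym (KP.+-assoc _ _ _))

  module _ {A : Set} (N : ℕ) (h : A → K.Carrier) (h≡0∨1+N : ∀ y → h y ≡ 0# ⊎ h y ≡ ι 𝕂 (suc N)) where
    sumL-ι : ∀ l → ∃ λ M → sumL l h ≡ ι 𝕂 M
    sumL-ι []      = 0 , refl
    sumL-ι (y ∷ l) with sumL-ι l | h≡0∨1+N y
    ... | M , Σ≡M | inj₁ hy≡0 = M , trans (cong₂ _+_ hy≡0 Σ≡M) (KP.+-identityˡ _)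
    ... | M , Σ≡M | inj₂ hy≡n = suc N +ℕ M , trans (cong₂ _+_ hy≡n Σ≡M) (sym (ι-+ (suc N) M))

    -- in characteristic 0 no cancellation is possible
    sumL-ι-vanishing : ∀ l → sumL l h ≡ 0# → All (λ y → h y ≡ 0#) l
    sumL-ι-vanishing []      _   = []
    sumL-ι-vanishing (y ∷ l) Σ≡0 with h≡0∨1+N y | sumL-ι l
    ... | inj₁ hy≡0 | _ = hy≡0 ∷ sumL-ι-vanishing l (trans (sym (KP.+-identityˡ _)) (trans (cong (_+ sumL l h) (sym hy≡0)) Σ≡0))
    ... | inj₂ hy≡n | M , Σ≡M = ⊥-elim (char0 (N +ℕ M) (trans (ι-+ (suc N) M) (trans (sym (cong₂ _+_ hy≡n Σ≡M)) Σ≡0)))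

  charSum-orthogonality : ∀ y → charSum y ≡ 𝟙[ y F.≟ F.1# ] * Q
  charSum-orthogonality y with y F.≟ F.1#
  ... | yes refl = trans charSum-1 (sym (KP.*-identityˡ Q))
  ... | no y≢1   = trans (sym (trans (cong (charSum y *_) (w≡1 y y≢1)) (KP.*-identityʳ _)))
                         (trans (lookup off-1≡0 (elems-complete y)) (sym (KP.zeroˡ Q)))
    where
    w : F.Carrier → K.Carrier
    w y = 𝟙[ ¬? (y F.≟ F.1#) ]
    w≡1 : ∀ y → y ≢ F.1# → w y ≡ 1#
    w≡1 y y≢1 with y F.≟ F.1#
    ... | yes y≡1 = ⊥-elim (y≢1 y≡1)
    ... | no _    = refl
    w1≡0 : w F.1# ≡ 0#
    w1≡0 with F.1# F.≟ F.1#
    ... | yes _   = refl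
    ... | no 1≢1  = ⊥-elim (1≢1 refl)
    off-1 : ∀ y → charSum y * w y ≡ 0# ⊎ charSum y * w y ≡ Q
    off-1 y with y F.≟ F.1# | charSum-dichotomy y
    ... | yes _ | _          = inj₁ (KP.zeroʳ _)
    ... | no _  | inj₁ S≡0   = inj₁ (trans (KP.*-identityʳ _) S≡0)
    ... | no _  | inj₂ S≡Q   = inj₂ (trans (KP.*-identityʳ _) S≡Q)
    off-1≡0 : All (λ y → charSum y * w y ≡ 0#) elems
    off-1≡0 with nonempty (chars-complete ε ε-isChar)
    ... | k , |chars|≡1+k = sumL-ι-vanishing k (λ y → charSum y * w y)
      (λ y → map₂ (λ e → trans e (cong (ι 𝕂) |chars|≡1+k)) (off-1 y)) elems
      (KP.+-cancelʳ Q _ _ (begin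
        Σ𝔽 (λ y → charSum y * w y) + Q          ≡⟨ cong (Σ𝔽 (λ y → charSum y * w y) +_) (sym charSum-1) ⟩
        Σ𝔽 (λ y → charSum y * w y) + charSum F.1# ≡⟨ Σ𝔽-puncture F.1# charSum w w1≡0 w≡1 ⟩
        Σ𝔽 charSum                              ≡⟨ Σ𝔽-charSum ⟩
        Q                                       ≡⟨ sym (KP.+-identityˡ Q) ⟩
        0# + Q                                  ∎))

  -- The beta kernel

  betaScale : Ch → Ch → K.Carrier
  betaScale a c = (g a) ⁻¹ * (g° c * (ι 𝕂 q) ⁻¹)

  -- a(-t) θ((1 - t)⁻¹) = a(-t) (ā c)(1 - t) plays the role of t^a (1 - t)^(c - a) in Euler's beta integral
  invOneMinus : F.Carrier → F.Carrier
  invOneMinus t = (F.1# F.+ F.- t) F.⁻¹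

  -- the kernel whose multiplicative Fourier coefficients are the ratios (a)_ν / (c)°_ν
  betaKernel : Ch → Ch → F.Carrier → K.Carrier
  betaKernel a c t =
    betaScale a c * ((- g (a · bar c)) * (c FP.-1# * (a (F.- t) * (a · bar c) (invOneMinus t)))
                     + 𝟙[ t F.≟ F.1# ] * (a FP.-1# * (c FP.-1# * (𝟙[ (a · bar c) ≈ᶜ? ε ] * Q))))

  ·-bar-cancel : ∀ {a c N} → IsChar a → IsChar N → ((a · N) · bar (c · N)) ≈ᶜ (a · bar c)
  ·-bar-cancel {a} {c} {N} ac Nc x with x F.≟ F.0#
  ... | yes refl = trans (cong (λ z → (z * N F.0#) * (c F.0# * N F.0#) ⁻¹) (IsMChar.at-0 ac))
                     (trans (cong (_* (c F.0# * N F.0#) ⁻¹) (KP.zeroˡ _))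
                       (trans (KP.zeroˡ _) (sym (trans (cong (_* (c F.0#) ⁻¹) (IsMChar.at-0 ac)) (KP.zeroˡ _)))))
  ... | no x≢0 = begin
    (a x * N x) * (c x * N x) ⁻¹            ≡⟨ cong ((a x * N x) *_) (KP.⁻¹-distrib-* _ _) ⟩
    (a x * N x) * ((c x) ⁻¹ * (N x) ⁻¹)     ≡⟨ KP.interchange (a x) (N x) ((c x) ⁻¹) ((N x) ⁻¹) ⟩
    (a x * (c x) ⁻¹) * (N x * (N x) ⁻¹)     ≡⟨ cong ((a x * (c x) ⁻¹) *_) (KP.⁻¹-inverseʳ _ (char-≢0 Nc x x≢0)) ⟩
    (a x * (c x) ⁻¹) * 1#                   ≡⟨ KP.*-identityʳ _ ⟩
    a x * (c x) ⁻¹                          ∎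

  module _ {a c N : Ch} (ac : IsChar a) (cc : IsChar c) (Nc : IsChar N) where
    private
      θ   = a · bar c
      θc  = ·-isChar ac (bar-isChar cc)
      aN  = a · N
      cN  = c · N
      cNc = ·-isChar cc Nc
      P≈θ = ·-bar-cancel {c = c} ac Nc

    -- the substitution s = -t
    N[-1]*jacobi : N FP.-1# * jacobi aN (bar cN) ≡ Σ𝔽 (λ t → a (F.- t) * θ (invOneMinus t) * N t)
    N[-1]*jacobi = begin
      N FP.-1# * jacobi aN (bar cN)
        ≡⟨ sym (sumL-*ˡ elems _ _) ⟩
      Σ𝔽 (λ s → N FP.-1# * (aN s * (aN · bar cN) ((F.1# F.+ s) F.⁻¹)))
        ≡⟨ Σ𝔽-neg _ ⟩
      Σ𝔽 (λ t → N FP.-1# * (aN (F.- t) * (aN · bar cN) (invOneMinus t)))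
        ≡⟨ sumL-cong elems pointwise ⟩
      Σ𝔽 (λ t → a (F.- t) * θ (invOneMinus t) * N t) ∎
      where
      pointwise : ∀ t → N FP.-1# * (aN (F.- t) * (aN · bar cN) (invOneMinus t)) ≡ a (F.- t) * θ (invOneMinus t) * N t
      pointwise t = begin
        N FP.-1# * ((a (F.- t) * N (F.- t)) * (aN · bar cN) (invOneMinus t))
          ≡⟨ cong (λ z → N FP.-1# * ((a (F.- t) * N (F.- t)) * z)) (P≈θ _) ⟩
        N FP.-1# * ((a (F.- t) * N (F.- t)) * θ (invOneMinus t))
          ≡⟨ solve 4 (λ A B C D → (A :* ((B :* C) :* D)) := ((B :* D) :* (A :* C))) refl (N FP.-1#) (a (F.- t)) (N (F.- t)) (θ (invOneMinus t)) ⟩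
        (a (F.- t) * θ (invOneMinus t)) * (N FP.-1# * N (F.- t))
          ≡⟨ cong ((a (F.- t) * θ (invOneMinus t)) *_) (trans (sym (IsMChar.mult Nc _ _)) (cong N -1*-t≡t)) ⟩
        a (F.- t) * θ (invOneMinus t) * N t ∎
        where
        -1*-t≡t : FP.-1# F.* (F.- t) ≡ t
        -1*-t≡t = trans (sym (FP.-x≡-1*x (F.- t))) (FP.-‿involutive t)

    Σ𝔽-betaKernel : Σ𝔽 (λ t → betaKernel a c t * N t)
                    ≡ betaScale a c * ((- g θ) * (c FP.-1# * Σ𝔽 (λ t → a (F.- t) * θ (invOneMinus t) * N t))
                                       + a FP.-1# * (c FP.-1# * (𝟙[ θ ≈ᶜ? ε ] * Q)))
    Σ𝔽-betaKernel = begin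
      Σ𝔽 (λ t → betaKernel a c t * N t)
        ≡⟨ sumL-cong elems (λ t → solve 4 (λ K X I M → ((K :* (X :+ I)) :* M) := (K :* (X :* M :+ I :* M))) refl _ _ _ (N t)) ⟩
      Σ𝔽 (λ t → betaScale a c * (X t * N t + (𝟙[ t F.≟ F.1# ] * C) * N t))
        ≡⟨ sumL-*ˡ elems _ _ ⟩
      betaScale a c * Σ𝔽 (λ t → X t * N t + (𝟙[ t F.≟ F.1# ] * C) * N t)
        ≡⟨ cong (betaScale a c *_) (sumL-+ elems _ _) ⟩
      betaScale a c * (Σ𝔽 (λ t → X t * N t) + Σ𝔽 (λ t → (𝟙[ t F.≟ F.1# ] * C) * N t))
        ≡⟨ cong (λ z → betaScale a c * (Σ𝔽 (λ t → X t * N t) + z)) C-term ⟩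
      betaScale a c * (Σ𝔽 (λ t → X t * N t) + C)
        ≡⟨ cong (λ z → betaScale a c * (z + C)) X-term ⟩
      betaScale a c * ((- g θ) * (c FP.-1# * Σ𝔽 (λ t → a (F.- t) * θ (invOneMinus t) * N t)) + C) ∎
      where
      X : F.Carrier → K.Carrier
      X t = (- g θ) * (c FP.-1# * (a (F.- t) * θ (invOneMinus t)))
      C = a FP.-1# * (c FP.-1# * (𝟙[ θ ≈ᶜ? ε ] * Q))
      C-term : Σ𝔽 (λ t → (𝟙[ t F.≟ F.1# ] * C) * N t) ≡ C
      C-term = trans (sumL-cong elems (λ t → KP.*-assoc _ _ _))
                 (trans (Σ𝔽-𝟙 F.1# (λ t → C * N t)) (trans (cong (C *_) (IsMChar.at-1 Nc)) (KP.*-identityʳ _)))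
      X-term : Σ𝔽 (λ t → X t * N t) ≡ (- g θ) * (c FP.-1# * Σ𝔽 (λ t → a (F.- t) * θ (invOneMinus t) * N t))
      X-term = trans (sumL-cong elems (λ t → solve 5 (λ G C A T M → ((G :* (C :* (A :* T))) :* M) := (G :* (C :* ((A :* T) :* M))))
                                                   refl (- g θ) (c FP.-1#) (a (F.- t)) (θ (invOneMinus t)) (N t)))
                     (trans (sumL-*ˡ elems _ _) (cong ((- g θ) *_) (sumL-*ˡ elems _ _)))

    poch/poch°≡Σ𝔽-betaKernel : poch a N * (poch° c N) ⁻¹ ≡ Σ𝔽 (λ t → betaKernel a c t * N t)
    poch/poch°≡Σ𝔽-betaKernel = begin
      (g aN * (g a) ⁻¹) * (g° cN * (g° c) ⁻¹) ⁻¹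
        ≡⟨ cong ((g aN * (g a) ⁻¹) *_) (trans (KP.⁻¹-distrib-* _ _) (cong (_* (g° c) ⁻¹ ⁻¹) (g°⁻¹ cNc))) ⟩
      (g aN * (g a) ⁻¹) * ((g (bar cN) * (cN FP.-1# * (ι 𝕂 q) ⁻¹)) * (g° c) ⁻¹ ⁻¹)
        ≡⟨ cong (λ z → (g aN * (g a) ⁻¹) * ((g (bar cN) * (cN FP.-1# * (ι 𝕂 q) ⁻¹)) * z)) (KP.⁻¹-involutive _) ⟩
      (g aN * (g a) ⁻¹) * ((g (bar cN) * (cN FP.-1# * (ι 𝕂 q) ⁻¹)) * g° c)
        ≡⟨ solve 6 (λ A B C D E G → ((A :* B) :* ((C :* (D :* E)) :* G)) := ((B :* (G :* E)) :* (D :* (A :* C)))) refl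
                 (g aN) ((g a) ⁻¹) (g (bar cN)) (cN FP.-1#) ((ι 𝕂 q) ⁻¹) (g° c) ⟩
      betaScale a c * (cN FP.-1# * (g aN * g (bar cN)))
        ≡⟨ cong (λ z → betaScale a c * (cN FP.-1# * z)) (g*g≡jacobi (·-isChar ac Nc) (bar-isChar cNc)) ⟩
      betaScale a c * (cN FP.-1# * ((- g (aN · bar cN)) * J + aN FP.-1# * Σ𝔽 (aN · bar cN)))
        ≡⟨ cong₂ (λ u v → betaScale a c * (cN FP.-1# * ((- u) * J + aN FP.-1# * v)))
                 (g-cong P≈θ) (trans (sumL-cong elems P≈θ) (Σ𝔽-char θc)) ⟩
      betaScale a c * (cN FP.-1# * ((- g θ) * J + aN FP.-1# * C))
        ≡⟨ cong (betaScale a c *_) (solve 6 (λ c′ N′ G J′ a′ C′ → ((c′ :* N′) :* (G :* J′ :+ (a′ :* N′) :* C′))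
                                                 := (G :* (c′ :* (N′ :* J′)) :+ (a′ :* (c′ :* C′)) :* (N′ :* N′)))
                                      refl (c FP.-1#) (N FP.-1#) (- g θ) J (a FP.-1#) C) ⟩
      betaScale a c * ((- g θ) * (c FP.-1# * (N FP.-1# * J)) + (a FP.-1# * (c FP.-1# * C)) * (N FP.-1# * N FP.-1#))
        ≡⟨ cong₂ (λ u v → betaScale a c * ((- g θ) * (c FP.-1# * u) + v)) N[-1]*jacobi
                 (trans (cong (a FP.-1# * (c FP.-1# * C) *_) (char[-1]²≡1 Nc)) (KP.*-identityʳ _)) ⟩
      betaScale a c * ((- g θ) * (c FP.-1# * Σ𝔽 (λ t → a (F.- t) * θ (invOneMinus t) * N t)) + a FP.-1# * (c FP.-1# * C))
        ≡⟨ sym Σ𝔽-betaKernel ⟩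
      Σ𝔽 (λ t → betaKernel a c t * N t) ∎
      where
      J = jacobi aN (bar cN)
      C = 𝟙[ θ ≈ᶜ? ε ] * Q

  -- The Euler integral representation of F_D

  prodK-cong : ∀ {m} {f h : Fin m → K.Carrier} → (∀ j → f j ≡ h j) → prodK f ≡ prodK h
  prodK-cong {zero}  f≗h = refl
  prodK-cong {suc m} f≗h = cong₂ _*_ (f≗h zero) (prodK-cong (λ j → f≗h (suc j)))

  prodK-* : ∀ {m} (f h : Fin m → K.Carrier) → prodK (λ j → f j * h j) ≡ prodK f * prodK h
  prodK-* {zero}  f h = sym (KP.*-identityˡ 1#)
  prodK-* {suc m} f h = trans (cong ((f zero * h zero) *_) (prodK-* (λ j → f (suc j)) (λ j → h (suc j))))
                              (KP.interchange (f zero) (h zero) _ _)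

  prodK-⁻¹ : ∀ {m} (f : Fin m → K.Carrier) → (prodK f) ⁻¹ ≡ prodK (λ j → (f j) ⁻¹)
  prodK-⁻¹ {zero}  f = KP.1⁻¹≡1
  prodK-⁻¹ {suc m} f = trans (KP.⁻¹-distrib-* _ _) (cong ((f zero) ⁻¹ *_) (prodK-⁻¹ (λ j → f (suc j))))

  prodK-neg : ∀ {m} (f : Fin m → K.Carrier) → prodK (λ j → - f j) ≡ powK -1# m * prodK f
  prodK-neg {zero}  f = sym (KP.*-identityˡ 1#)
  prodK-neg {suc m} f = trans (cong₂ _*_ (KP.-x≡-1*x (f zero)) (prodK-neg (λ j → f (suc j))))
                              (KP.interchange -1# (f zero) _ _)

  powK-* : ∀ a b m → powK (a * b) m ≡ powK a m * powK b m
  powK-* a b zero    = sym (KP.*-identityˡ 1#)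
  powK-* a b (suc m) = trans (cong ((a * b) *_) (powK-* a b m)) (KP.interchange a b _ _)

  powK-1 : ∀ m → powK 1# m ≡ 1#
  powK-1 zero    = refl
  powK-1 (suc m) = trans (cong (1# *_) (powK-1 m)) (KP.*-identityˡ 1#)

  powK-≢0 : ∀ a m → a ≢ 0# → powK a m ≢ 0#
  powK-≢0 a zero    a≢0 = KP.1≢0
  powK-≢0 a (suc m) a≢0 = KP.*-≢0 a≢0 (powK-≢0 a m a≢0)

  1-q≡-Q : 1# + - ι 𝕂 q ≡ -1# * Q
  1-q≡-Q = begin
    1# + - ι 𝕂 q       ≡⟨ cong (λ z → 1# + - z) ι-q≡1+Q ⟩
    1# + - (1# + Q)    ≡⟨ KP.+-inverseˡ-unique _ Q (trans (solve 3 (λ x y z → ((x :+ y) :+ z) := ((x :+ z) :+ y)) refl 1# (- (1# + Q)) Q)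
                                                         (KP.-‿inverseʳ (1# + Q))) ⟩
    - Q                ≡⟨ KP.-x≡-1*x Q ⟩
    -1# * Q            ∎

  -- the normalising factor (1 - q)^{-m} of F_D against the m sums over characters
  normalisation : ∀ m → (powK (1# + - ι 𝕂 q) m) ⁻¹ * powK Q m ≡ powK -1# m
  normalisation m = begin
    (powK (1# + - ι 𝕂 q) m) ⁻¹ * powK Q m            ≡⟨ cong (λ z → (powK z m) ⁻¹ * powK Q m) 1-q≡-Q ⟩
    (powK (-1# * Q) m) ⁻¹ * powK Q m                 ≡⟨ cong (λ z → z ⁻¹ * powK Q m) (powK-* _ _ m) ⟩
    (powK -1# m * powK Q m) ⁻¹ * powK Q m            ≡⟨ cong (_* powK Q m) (KP.⁻¹-distrib-* _ _) ⟩
    ((powK -1# m) ⁻¹ * (powK Q m) ⁻¹) * powK Q m     ≡⟨ KP.*-assoc _ _ _ ⟩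
    (powK -1# m) ⁻¹ * ((powK Q m) ⁻¹ * powK Q m)     ≡⟨ cong ((powK -1# m) ⁻¹ *_) (KP.⁻¹-inverseˡ _ (powK-≢0 Q m Q≢0)) ⟩
    (powK -1# m) ⁻¹ * 1#                             ≡⟨ KP.*-identityʳ _ ⟩
    (powK -1# m) ⁻¹                                  ≡⟨ sym (KP.⁻¹-unique _ _ -1ᵐ*-1ᵐ≡1) ⟩
    powK -1# m                                       ∎
    where
    -1ᵐ*-1ᵐ≡1 : powK -1# m * powK -1# m ≡ 1#
    -1ᵐ*-1ᵐ≡1 = trans (sym (powK-* _ _ m)) (trans (cong (λ z → powK z m) KP.-1*-1≡1) (powK-1 m))

  *ε-absorb : ∀ {f : F.Carrier → K.Carrier} → f F.0# ≡ 0# → ∀ s → f s * ε s ≡ f s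
  *ε-absorb {f} f0≡0 s with s F.≟ F.0#
  ... | yes refl = trans (KP.zeroʳ _) (sym f0≡0)
  ... | no _     = KP.*-identityʳ _

  sumTuples-congᴬ : ∀ m {f h : (Fin m → Ch) → K.Carrier} → (∀ νs → (∀ j → IsChar (νs j)) → f νs ≡ h νs) →
                    sumTuples m f ≡ sumTuples m h
  sumTuples-congᴬ zero    f≗h = f≗h (λ ()) (λ ())
  sumTuples-congᴬ (suc m) f≗h = sumL-congᴬ chars-char (λ ν νc →
    sumTuples-congᴬ m (λ νs νsc → f≗h (ν ∷ᵛ νs) (λ { zero → νc ; (suc j) → νsc j })))

  Σ𝔽-𝟙-inverse : ∀ (E : F.Carrier → K.Carrier) → E F.0# ≡ 0# → ∀ u →
                 Σ𝔽 (λ t → E t * (𝟙[ (t F.* u) F.≟ F.1# ] * Q)) ≡ Q * E (u F.⁻¹)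
  Σ𝔽-𝟙-inverse E E0≡0 u with u F.≟ F.0#
  ... | yes refl = trans (sumL-cong elems (λ t → trans (cong (λ z → E t * (z * Q)) (𝟙≡0 (_ F.≟ F.1#) (t*0≢1 t)))
                                                  (trans (cong (E t *_) (KP.zeroˡ Q)) (KP.zeroʳ _))))
                     (trans (sumL-0 elems) (sym (trans (cong (λ z → Q * E z) F.⁻¹-zero) (trans (cong (Q *_) E0≡0) (KP.zeroʳ Q)))))
    where
    t*0≢1 : ∀ t → t F.* F.0# ≢ F.1#
    t*0≢1 t e = FP.0≢1 (trans (sym (FP.zeroʳ t)) e)
  ... | no u≢0 = begin
    Σ𝔽 (λ t → E t * (𝟙[ (t F.* u) F.≟ F.1# ] * Q))
      ≡⟨ sumL-cong elems (λ t → trans (cong (λ z → E t * (z * Q)) (𝟙-cong (_ F.≟ F.1#) (t F.≟ (u F.⁻¹)) (tu≡1⇒t≡u⁻¹ t) (t≡u⁻¹⇒tu≡1 t)))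
                                       (KP.x∙yz≈y∙xz (E t) _ Q)) ⟩
    Σ𝔽 (λ t → 𝟙[ t F.≟ (u F.⁻¹) ] * (E t * Q))
      ≡⟨ Σ𝔽-𝟙 (u F.⁻¹) (λ t → E t * Q) ⟩
    E (u F.⁻¹) * Q
      ≡⟨ KP.*-comm _ _ ⟩
    Q * E (u F.⁻¹) ∎
    where
    tu≡1⇒t≡u⁻¹ : ∀ t → t F.* u ≡ F.1# → t ≡ u F.⁻¹
    tu≡1⇒t≡u⁻¹ t tu≡1 = FP.⁻¹-unique u t (trans (FP.*-comm u t) tu≡1)
    t≡u⁻¹⇒tu≡1 : ∀ t → t ≡ u F.⁻¹ → t F.* u ≡ F.1#
    t≡u⁻¹⇒tu≡1 t refl = FP.⁻¹-inverseˡ u u≢0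

  -- summing over ν kills everything but the terms with t = (s λ)⁻¹
  Σchars-orthogonality : ∀ (E : F.Carrier → K.Carrier) → E F.0# ≡ 0# → ∀ s l →
                         sumL chars (λ ν → ν s * Σ𝔽 (λ t → E t * ν (t F.* l))) ≡ Q * E ((s F.* l) F.⁻¹)
  Σchars-orthogonality E E0≡0 s l = begin
    sumL chars (λ ν → ν s * Σ𝔽 (λ t → E t * ν (t F.* l)))
      ≡⟨ sumL-cong chars (λ ν → sym (sumL-*ˡ elems (ν s) _)) ⟩
    sumL chars (λ ν → Σ𝔽 (λ t → ν s * (E t * ν (t F.* l))))
      ≡⟨ sumL-comm chars elems _ ⟩
    Σ𝔽 (λ t → sumL chars (λ ν → ν s * (E t * ν (t F.* l))))
      ≡⟨ sumL-cong elems (λ t → trans (sumL-congᴬ chars-char (λ ν νc → pointwise ν νc t)) (sumL-*ˡ chars (E t) _)) ⟩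
    Σ𝔽 (λ t → E t * charSum (t F.* (s F.* l)))
      ≡⟨ sumL-cong elems (λ t → cong (E t *_) (charSum-orthogonality _)) ⟩
    Σ𝔽 (λ t → E t * (𝟙[ (t F.* (s F.* l)) F.≟ F.1# ] * Q))
      ≡⟨ Σ𝔽-𝟙-inverse E E0≡0 (s F.* l) ⟩
    Q * E ((s F.* l) F.⁻¹) ∎
    where
    pointwise : ∀ ν → IsChar ν → ∀ t → ν s * (E t * ν (t F.* l)) ≡ E t * ν (t F.* (s F.* l))
    pointwise ν νc t = trans (KP.x∙yz≈y∙xz (ν s) (E t) _)
                             (cong (E t *_) (trans (sym (IsMChar.mult νc s _)) (cong ν (FP.x∙yz≈y∙xz s t l))))

  sumTuples-orthogonality :
    ∀ m (w : F.Carrier → K.Carrier) → w F.0# ≡ 0# →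
    (E : Fin m → F.Carrier → K.Carrier) → (∀ j → E j F.0# ≡ 0#) → (λs : Fin m → F.Carrier) →
    sumTuples m (λ νs → Σ𝔽 (λ s → w s * prodCh νs s) * prodK (λ j → Σ𝔽 (λ t → E j t * νs j (t F.* λs j))))
      ≡ powK Q m * Σ𝔽 (λ s → w s * prodK (λ j → E j ((s F.* λs j) F.⁻¹)))
  sumTuples-orthogonality zero w w0≡0 E E0≡0 λs = begin
    Σ𝔽 (λ s → w s * ε s) * 1#     ≡⟨ KP.*-identityʳ _ ⟩
    Σ𝔽 (λ s → w s * ε s)          ≡⟨ sumL-cong elems (λ s → trans (*ε-absorb w0≡0 s) (sym (KP.*-identityʳ _))) ⟩
    Σ𝔽 (λ s → w s * 1#)           ≡⟨ sym (KP.*-identityˡ _) ⟩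
    1# * Σ𝔽 (λ s → w s * 1#)      ∎
  sumTuples-orthogonality (suc m) w w0≡0 E E0≡0 λs = begin
    sumL chars (λ ν → sumTuples m (λ νs → Σ𝔽 (λ s → w s * (ν s * prodCh νs s)) * (A ν * R νs)))
      ≡⟨ sumL-cong chars (λ ν → sumTuples-congᴬ m (λ νs _ → absorb-A ν νs)) ⟩
    sumL chars (λ ν → sumTuples m (λ νs → Σ𝔽 (λ s → w′ ν s * prodCh νs s) * R νs))
      ≡⟨ sumL-congᴬ chars-char (λ ν νc → sumTuples-orthogonality m (w′ ν) (w′0≡0 ν) (λ j → E (suc j)) (λ j → E0≡0 (suc j)) (λ j → λs (suc j))) ⟩
    sumL chars (λ ν → powK Q m * Σ𝔽 (λ s → w′ ν s * R′ s))
      ≡⟨ sumL-*ˡ chars _ _ ⟩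
    powK Q m * sumL chars (λ ν → Σ𝔽 (λ s → w′ ν s * R′ s))
      ≡⟨ cong (powK Q m *_) (sumL-comm chars elems _) ⟩
    powK Q m * Σ𝔽 (λ s → sumL chars (λ ν → w′ ν s * R′ s))
      ≡⟨ cong (powK Q m *_) (sumL-cong elems sum-ν) ⟩
    powK Q m * Σ𝔽 (λ s → Q * (w s * (E zero ((s F.* λs zero) F.⁻¹) * R′ s)))
      ≡⟨ cong (powK Q m *_) (sumL-*ˡ elems _ _) ⟩
    powK Q m * (Q * Σ𝔽 (λ s → w s * (E zero ((s F.* λs zero) F.⁻¹) * R′ s)))
      ≡⟨ KP.x∙yz≈yx∙z (powK Q m) Q _ ⟩
    (Q * powK Q m) * Σ𝔽 (λ s → w s * (E zero ((s F.* λs zero) F.⁻¹) * R′ s)) ∎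
    where
    A : Ch → K.Carrier
    A ν = Σ𝔽 (λ t → E zero t * ν (t F.* λs zero))
    R : (Fin m → Ch) → K.Carrier
    R νs = prodK (λ j → Σ𝔽 (λ t → E (suc j) t * νs j (t F.* λs (suc j))))
    R′ : F.Carrier → K.Carrier
    R′ s = prodK (λ j → E (suc j) ((s F.* λs (suc j)) F.⁻¹))
    w′ : Ch → F.Carrier → K.Carrier
    w′ ν s = (w s * ν s) * A ν
    w′0≡0 : ∀ ν → w′ ν F.0# ≡ 0#
    w′0≡0 ν = trans (cong (λ z → (z * ν F.0#) * A ν) w0≡0) (trans (cong (_* A ν) (KP.zeroˡ _)) (KP.zeroˡ _))
    absorb-A : ∀ ν νs → Σ𝔽 (λ s → w s * (ν s * prodCh νs s)) * (A ν * R νs) ≡ Σ𝔽 (λ s → w′ ν s * prodCh νs s) * R νs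
    absorb-A ν νs = begin
      Σ𝔽 (λ s → w s * (ν s * prodCh νs s)) * (A ν * R νs)    ≡⟨ sym (KP.*-assoc _ _ _) ⟩
      (Σ𝔽 (λ s → w s * (ν s * prodCh νs s)) * A ν) * R νs    ≡⟨ cong (_* R νs) (sym (sumL-*ʳ elems _ _)) ⟩
      Σ𝔽 (λ s → (w s * (ν s * prodCh νs s)) * A ν) * R νs    ≡⟨ cong (_* R νs) (sumL-cong elems (λ s →
          solve 4 (λ W V P Aν → ((W :* (V :* P)) :* Aν) := (((W :* V) :* Aν) :* P)) refl (w s) (ν s) (prodCh νs s) (A ν))) ⟩
      Σ𝔽 (λ s → w′ ν s * prodCh νs s) * R νs                 ∎
    sum-ν : ∀ s → sumL chars (λ ν → w′ ν s * R′ s) ≡ Q * (w s * (E zero ((s F.* λs zero) F.⁻¹) * R′ s))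
    sum-ν s = begin
      sumL chars (λ ν → ((w s * ν s) * A ν) * R′ s)
        ≡⟨ sumL-cong chars (λ ν → solve 4 (λ W V Aν Rs → (((W :* V) :* Aν) :* Rs) := ((W :* Rs) :* (V :* Aν))) refl (w s) (ν s) (A ν) (R′ s)) ⟩
      sumL chars (λ ν → (w s * R′ s) * (ν s * A ν))
        ≡⟨ sumL-*ˡ chars _ _ ⟩
      (w s * R′ s) * sumL chars (λ ν → ν s * A ν)
        ≡⟨ cong ((w s * R′ s) *_) (Σchars-orthogonality (E zero) (E0≡0 zero) s (λs zero)) ⟩
      (w s * R′ s) * (Q * E zero ((s F.* λs zero) F.⁻¹))
        ≡⟨ solve 4 (λ W Rs Q′ Es → ((W :* Rs) :* (Q′ :* Es)) := (Q′ :* (W :* (Es :* Rs)))) refl (w s) (R′ s) Q (E zero ((s F.* λs zero) F.⁻¹)) ⟩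
      Q * (w s * (E zero ((s F.* λs zero) F.⁻¹) * R′ s)) ∎

  binomialKernel : Ch → F.Carrier → K.Carrier
  binomialKernel b t = - betaKernel b ε t

  kernelProd : ∀ {m} → F.Carrier → (Fin m → Ch) → (Fin m → F.Carrier) → K.Carrier
  kernelProd s β λs = prodK (λ j → binomialKernel (β j) ((s F.* λs j) F.⁻¹))

  betaKernel-0 : ∀ {a} c → IsChar a → betaKernel a c F.0# ≡ 0#
  betaKernel-0 {a} c ac = begin
    betaScale a c * ((- g θ) * (c FP.-1# * (a (F.- F.0#) * θ (invOneMinus F.0#))) + 𝟙[ F.0# F.≟ F.1# ] * C)
      ≡⟨ cong₂ (λ u v → betaScale a c * ((- g θ) * (c FP.-1# * (u * θ (invOneMinus F.0#))) + v * C))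
               (trans (cong a FP.-0#≈0#) (IsMChar.at-0 ac)) (𝟙≡0 (F.0# F.≟ F.1#) FP.0≢1) ⟩
    betaScale a c * ((- g θ) * (c FP.-1# * (0# * θ (invOneMinus F.0#))) + 0# * C)
      ≡⟨ solve 5 (λ K G c′ T C′ → (K :* (G :* (c′ :* (con 0 :* T)) :+ con 0 :* C′)) := con 0) refl
               (betaScale a c) (- g θ) (c FP.-1#) (θ (invOneMinus F.0#)) C ⟩
    0# ∎
    where
    θ = a · bar c
    C = a FP.-1# * (c FP.-1# * (𝟙[ θ ≈ᶜ? ε ] * Q))

  binomialKernel-0 : ∀ {b} → IsChar b → binomialKernel b F.0# ≡ 0#
  binomialKernel-0 bc = trans (cong -_ (betaKernel-0 ε bc)) KP.-0#≈0#

  poch-ε : ∀ {a} → IsChar a → poch a ε ≡ 1#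
  poch-ε {a} ac = trans (cong (_* (g a) ⁻¹) (g-cong (char·ε≈char ac))) (KP.⁻¹-inverseʳ _ (g-≢0 ac))

  poch°-ε : ∀ {a} → IsChar a → poch° a ε ≡ 1#
  poch°-ε {a} ac = trans (cong (_* (g° a) ⁻¹) (g°-cong (char·ε≈char ac))) (KP.⁻¹-inverseʳ _ (g°-≢0 ac))

  poch/poch°ε≡Σ𝔽-betaKernel : ∀ {b ν} l → IsChar b → IsChar ν →
    (poch b ν * (poch° ε ν) ⁻¹) * ν l ≡ Σ𝔽 (λ t → betaKernel b ε t * ν (t F.* l))
  poch/poch°ε≡Σ𝔽-betaKernel {b} {ν} l bc νc = begin
    (poch b ν * (poch° ε ν) ⁻¹) * ν l        ≡⟨ cong (_* ν l) (poch/poch°≡Σ𝔽-betaKernel bc ε-isChar νc) ⟩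
    Σ𝔽 (λ t → betaKernel b ε t * ν t) * ν l  ≡⟨ sym (sumL-*ʳ elems _ _) ⟩
    Σ𝔽 (λ t → (betaKernel b ε t * ν t) * ν l) ≡⟨ sumL-cong elems (λ t → trans (KP.*-assoc _ _ _) (cong (_ *_) (sym (IsMChar.mult νc t l)))) ⟩
    Σ𝔽 (λ t → betaKernel b ε t * ν (t F.* l)) ∎

  module _ {m} {α γ : Ch} {β : Fin m → Ch} (αc : IsChar α) (βc : ∀ j → IsChar (β j)) (γc : IsChar γ)
           (λs : Fin m → F.Carrier) where

    FD-summand : ∀ νs → (∀ j → IsChar (νs j)) →
      poch α (prodCh νs) * prodK (λ j → poch (β j) (νs j))
        * (poch° γ (prodCh νs) * prodK (λ j → poch° ε (νs j))) ⁻¹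
        * prodK (λ j → νs j (λs j))
      ≡ Σ𝔽 (λ s → betaKernel α γ s * prodCh νs s) * prodK (λ j → Σ𝔽 (λ t → betaKernel (β j) ε t * νs j (t F.* λs j)))
    FD-summand νs νsc = begin
      A * PB * (C * PE) ⁻¹ * PL
        ≡⟨ cong (λ z → A * PB * z * PL) (trans (KP.⁻¹-distrib-* C PE) (cong (C ⁻¹ *_) (prodK-⁻¹ (λ j → poch° ε (νs j))))) ⟩
      A * PB * (C ⁻¹ * PE′) * PL
        ≡⟨ solve 5 (λ A′ B′ C′ E′ L′ → (A′ :* B′ :* (C′ :* E′) :* L′) := ((A′ :* C′) :* ((B′ :* E′) :* L′))) refl A PB (C ⁻¹) PE′ PL ⟩
      (A * C ⁻¹) * ((PB * PE′) * PL)
        ≡⟨ cong ((A * C ⁻¹) *_) (trans (cong (_* PL) (sym (prodK-* (λ j → poch (β j) (νs j)) (λ j → (poch° ε (νs j)) ⁻¹))))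
                                       (sym (prodK-* (λ j → poch (β j) (νs j) * (poch° ε (νs j)) ⁻¹) (λ j → νs j (λs j))))) ⟩
      (A * C ⁻¹) * prodK (λ j → (poch (β j) (νs j) * (poch° ε (νs j)) ⁻¹) * νs j (λs j))
        ≡⟨ cong₂ _*_ (poch/poch°≡Σ𝔽-betaKernel αc γc (prodCh-isChar νs νsc))
                     (prodK-cong (λ j → poch/poch°ε≡Σ𝔽-betaKernel (λs j) (βc j) (νsc j))) ⟩
      Σ𝔽 (λ s → betaKernel α γ s * prodCh νs s) * prodK (λ j → Σ𝔽 (λ t → betaKernel (β j) ε t * νs j (t F.* λs j))) ∎
      where
      A   = poch α (prodCh νs)
      C   = poch° γ (prodCh νs)
      PB  = prodK (λ j → poch (β j) (νs j))
      PE  = prodK (λ j → poch° ε (νs j))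
      PE′ = prodK (λ j → (poch° ε (νs j)) ⁻¹)
      PL  = prodK (λ j → νs j (λs j))

  FD≡Σ𝔽-kernels : ∀ m {α γ : Ch} {β : Fin m → Ch} → IsChar α → (∀ j → IsChar (β j)) → IsChar γ → (λs : Fin m → F.Carrier) →
                  FD m α β γ λs ≡ Σ𝔽 (λ s → betaKernel α γ s * kernelProd s β λs)
  FD≡Σ𝔽-kernels zero {α} {γ} αc βc γc λs = begin
    1#
      ≡⟨ sym (trans (cong₂ _*_ (poch-ε αc) (trans (cong _⁻¹ (poch°-ε γc)) KP.1⁻¹≡1)) (KP.*-identityˡ 1#)) ⟩
    poch α ε * (poch° γ ε) ⁻¹
      ≡⟨ poch/poch°≡Σ𝔽-betaKernel αc γc ε-isChar ⟩
    Σ𝔽 (λ s → betaKernel α γ s * ε s)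
      ≡⟨ sumL-cong elems (λ s → trans (*ε-absorb (betaKernel-0 γ αc) s) (sym (KP.*-identityʳ _))) ⟩
    Σ𝔽 (λ s → betaKernel α γ s * 1#) ∎
  FD≡Σ𝔽-kernels (suc m) {α} {γ} {β} αc βc γc λs = begin
    FD (suc m) α β γ λs
      ≡⟨ cong (Z ⁻¹ *_) (sumTuples-congᴬ (suc m) {f = summand} (FD-summand αc βc γc λs)) ⟩
    Z ⁻¹ * sumTuples (suc m) (λ νs → Σ𝔽 (λ s → betaKernel α γ s * prodCh νs s)
                                      * prodK (λ j → Σ𝔽 (λ t → betaKernel (β j) ε t * νs j (t F.* λs j))))
      ≡⟨ cong (Z ⁻¹ *_) (sumTuples-orthogonality (suc m) (betaKernel α γ) (betaKernel-0 γ αc)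
                          (λ j → betaKernel (β j) ε) (λ j → betaKernel-0 ε (βc j)) λs) ⟩
    Z ⁻¹ * (powK Q (suc m) * Σβ)
      ≡⟨ sym (KP.*-assoc _ _ _) ⟩
    (Z ⁻¹ * powK Q (suc m)) * Σβ
      ≡⟨ cong (_* Σβ) (normalisation (suc m)) ⟩
    powK -1# (suc m) * Σβ
      ≡⟨ sym (sumL-*ˡ elems _ _) ⟩
    Σ𝔽 (λ s → powK -1# (suc m) * (betaKernel α γ s * prodK (λ j → betaKernel (β j) ε ((s F.* λs j) F.⁻¹))))
      ≡⟨ sumL-cong elems (λ s → trans (KP.x∙yz≈y∙xz (powK -1# (suc m)) (betaKernel α γ s) _)
                                      (cong (betaKernel α γ s *_) (sym (prodK-neg (λ j → betaKernel (β j) ε ((s F.* λs j) F.⁻¹)))))) ⟩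
    Σ𝔽 (λ s → betaKernel α γ s * kernelProd s β λs) ∎
    where
    Z = powK (1# + - ι 𝕂 q) (suc m)
    summand : (Fin (suc m) → Ch) → K.Carrier
    summand νs = poch α (prodCh νs) * prodK (λ j → poch (β j) (νs j))
                   * (poch° γ (prodCh νs) * prodK (λ j → poch° ε (νs j))) ⁻¹
                   * prodK (λ j → νs j (λs j))
    Σβ = Σ𝔽 (λ s → betaKernel α γ s * prodK (λ j → betaKernel (β j) ε ((s F.* λs j) F.⁻¹)))

  -- The binomial kernel

  betaKernel-≢1 : ∀ a c t → t ≢ F.1# →
                  betaKernel a c t ≡ betaScale a c * ((- g (a · bar c)) * (c FP.-1# * (a (F.- t) * (a · bar c) (invOneMinus t))))
  betaKernel-≢1 a c t t≢1 = cong (betaScale a c *_)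
    (trans (cong (X +_) (trans (cong (_* C) (𝟙≡0 (t F.≟ F.1#) t≢1)) (KP.zeroˡ _))) (KP.+-identityʳ _))
    where
    X = (- g (a · bar c)) * (c FP.-1# * (a (F.- t) * (a · bar c) (invOneMinus t)))
    C = a FP.-1# * (c FP.-1# * (𝟙[ (a · bar c) ≈ᶜ? ε ] * Q))

  betaKernel-1 : ∀ {a} c → IsChar a → ¬ (a · bar c) ≈ᶜ ε → betaKernel a c F.1# ≡ 0#
  betaKernel-1 {a} c ac θ≉ε = begin
    betaScale a c * ((- g θ) * (c FP.-1# * (a (F.- F.1#) * θ (invOneMinus F.1#))) + 𝟙[ F.1# F.≟ F.1# ] * (a FP.-1# * (c FP.-1# * (𝟙[ θ ≈ᶜ? ε ] * Q))))
      ≡⟨ cong₂ (λ u v → betaScale a c * ((- g θ) * (c FP.-1# * (a (F.- F.1#) * u)) + 𝟙[ F.1# F.≟ F.1# ] * (a FP.-1# * (c FP.-1# * (v * Q)))))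
               θ[1-1]≡0 (𝟙≡0 (θ ≈ᶜ? ε) θ≉ε) ⟩
    betaScale a c * ((- g θ) * (c FP.-1# * (a (F.- F.1#) * 0#)) + 𝟙[ F.1# F.≟ F.1# ] * (a FP.-1# * (c FP.-1# * (0# * Q))))
      ≡⟨ solve 7 (λ K G c′ A I a′ Q′ → (K :* (G :* (c′ :* (A :* con 0)) :+ I :* (a′ :* (c′ :* (con 0 :* Q′))))) := con 0) refl
               (betaScale a c) (- g θ) (c FP.-1#) (a (F.- F.1#)) 𝟙[ F.1# F.≟ F.1# ] (a FP.-1#) Q ⟩
    0# ∎
    where
    θ = a · bar c
    θ[1-1]≡0 : θ (invOneMinus F.1#) ≡ 0#
    θ[1-1]≡0 = trans (cong θ (trans (cong F._⁻¹ (FP.-‿inverseʳ F.1#)) F.⁻¹-zero)) (trans (cong (_* (c F.0#) ⁻¹) (IsMChar.at-0 ac)) (KP.zeroˡ _))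

  -- b(-t) b((1-t)⁻¹), the finite-field analogue of (1 - 1/t)^{-b}
  binomialWeight : Ch → F.Carrier → K.Carrier
  binomialWeight b t = b (F.- t) * b (invOneMinus t)

  binomialKernel-≢1 : ∀ {b} → IsChar b → ∀ t → t ≢ F.1# → binomialKernel b t ≡ binomialWeight b t
  binomialKernel-≢1 {b} bc t t≢1 = begin
    - betaKernel b ε t
      ≡⟨ cong -_ (betaKernel-≢1 b ε t t≢1) ⟩
    - (betaScale b ε * ((- g (b · bar ε)) * (ε FP.-1# * (b (F.- t) * (b · bar ε) (invOneMinus t)))))
      ≡⟨ cong₂ (λ u v → - (u * ((- g (b · bar ε)) * v))) betaScale-ε
               (cong₂ _*_ (ε-≢0 _ FP.-1≢0) (cong (b (F.- t) *_) (b·ε̄≈b (invOneMinus t)))) ⟩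
    - ((g b) ⁻¹ * ((- g (b · bar ε)) * (1# * binomialWeight b t)))
      ≡⟨ cong (λ z → - ((g b) ⁻¹ * ((- z) * (1# * binomialWeight b t)))) (g-cong b·ε̄≈b) ⟩
    - ((g b) ⁻¹ * ((- g b) * (1# * binomialWeight b t)))
      ≡⟨ cong -_ (trans (cong ((g b) ⁻¹ *_) (sym (KP.-‿distribˡ-* _ _))) (sym (KP.-‿distribʳ-* _ _))) ⟩
    - - ((g b) ⁻¹ * (g b * (1# * binomialWeight b t)))
      ≡⟨ KP.-‿involutive _ ⟩
    (g b) ⁻¹ * (g b * (1# * binomialWeight b t))
      ≡⟨ trans (sym (KP.*-assoc _ _ _)) (cong₂ _*_ (KP.⁻¹-inverseˡ _ (g-≢0 bc)) (KP.*-identityˡ _)) ⟩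
    1# * binomialWeight b t
      ≡⟨ KP.*-identityˡ _ ⟩
    binomialWeight b t ∎
    where
    b·ε̄≈b : (b · bar ε) ≈ᶜ b
    b·ε̄≈b x = trans (cong (b x *_) (ε-⁻¹ x)) (char·ε≈char bc x)
    betaScale-ε : betaScale b ε ≡ (g b) ⁻¹
    betaScale-ε = begin
      (g b) ⁻¹ * (g° ε * (ι 𝕂 q) ⁻¹)          ≡⟨ cong (λ z → (g b) ⁻¹ * (z * (ι 𝕂 q) ⁻¹)) (trans (g°-trivial (λ _ → refl)) (cong (ι 𝕂 q *_) g-ε)) ⟩
      (g b) ⁻¹ * ((ι 𝕂 q * 1#) * (ι 𝕂 q) ⁻¹)  ≡⟨ cong (λ z → (g b) ⁻¹ * (z * (ι 𝕂 q) ⁻¹)) (KP.*-identityʳ _) ⟩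
      (g b) ⁻¹ * (ι 𝕂 q * (ι 𝕂 q) ⁻¹)         ≡⟨ cong ((g b) ⁻¹ *_) (KP.⁻¹-inverseʳ _ ι-q≢0) ⟩
      (g b) ⁻¹ * 1#                           ≡⟨ KP.*-identityʳ _ ⟩
      (g b) ⁻¹                                ∎

  binomialKernel-1 : ∀ {b} → IsChar b → ¬ b ≈ᶜ ε → binomialKernel b F.1# ≡ 0#
  binomialKernel-1 {b} bc b≉ε = trans (cong -_ (betaKernel-1 ε bc b·ε̄≉ε)) KP.-0#≈0#
    where
    b·ε̄≉ε : ¬ (b · bar ε) ≈ᶜ ε
    b·ε̄≉ε e = b≉ε (λ x → trans (sym (trans (cong (b x *_) (ε-⁻¹ x)) (char·ε≈char bc x))) (e x))

  binomialWeight-· : ∀ a b t → binomialWeight (a · b) t ≡ binomialWeight a t * binomialWeight b t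
  binomialWeight-· a b t = KP.interchange (a (F.- t)) (b (F.- t)) (a (invOneMinus t)) (b (invOneMinus t))

  binomialWeight-ε : ∀ t → t ≢ F.0# → t ≢ F.1# → binomialWeight ε t ≡ 1#
  binomialWeight-ε t t≢0 t≢1 = trans (cong₂ _*_ (ε-≢0 _ -t≢0) (ε-≢0 _ (FP.⁻¹-≢0 _ 1-t≢0))) (KP.*-identityˡ 1#)
    where
    -t≢0 : F.- t ≢ F.0#
    -t≢0 -t≡0 = t≢0 (trans (sym (FP.-‿involutive t)) (trans (cong F.-_ -t≡0) FP.-0#≈0#))
    1-t≢0 : F.1# F.+ F.- t ≢ F.0#
    1-t≢0 e = t≢1 (sym (trans (FP.+-inverseˡ-unique F.1# (F.- t) e) (FP.-‿involutive t)))

  binomialWeight-prodCh : ∀ {n} (v : Fin n → Ch) t → t ≢ F.0# → t ≢ F.1# →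
                          binomialWeight (prodCh v) t ≡ prodK (λ j → binomialWeight (v j) t)
  binomialWeight-prodCh {zero}  v t t≢0 t≢1 = binomialWeight-ε t t≢0 t≢1
  binomialWeight-prodCh {suc n} v t t≢0 t≢1 = trans (binomialWeight-· (v zero) (prodCh (λ j → v (suc j))) t)
    (cong (binomialWeight (v zero) t *_) (binomialWeight-prodCh (λ j → v (suc j)) t t≢0 t≢1))

  maskedProd : ∀ {n} → (Fin n → Bool) → (Fin n → Ch) → Ch
  maskedProd mask β = prodCh (λ j → if mask j then ε else β j)

  maskedProdK : ∀ {n} → (Fin n → Bool) → (Fin n → Ch) → F.Carrier → K.Carrier
  maskedProdK mask β t = prodK (λ j → if mask j then 1# else binomialKernel (β j) t)

  maskedProd-isChar : ∀ {n} (mask : Fin n → Bool) {β : Fin n → Ch} → (∀ j → IsChar (β j)) → IsChar (maskedProd mask β)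
  maskedProd-isChar mask {β} βc = prodCh-isChar _ masked-isChar
    where
    masked-isChar : ∀ j → IsChar (if mask j then ε else β j)
    masked-isChar j with mask j
    ... | true  = ε-isChar
    ... | false = βc j

  prodCh-trivial : ∀ {n} (v : Fin n → Ch) → (∀ j → v j ≈ᶜ ε) → prodCh v ≈ᶜ ε
  prodCh-trivial {zero}  v v≈ε x = refl
  prodCh-trivial {suc n} v v≈ε x = trans (cong₂ _*_ (v≈ε zero x) (prodCh-trivial (λ j → v (suc j)) (λ j → v≈ε (suc j)) x)) (ε² x)
    where
    ε² : ∀ x → ε x * ε x ≡ ε x
    ε² x with x F.≟ F.0#
    ... | yes _ = KP.zeroˡ _
    ... | no _  = KP.*-identityˡ _

  maskedProdK-0-or-trivial : ∀ {n} (mask : Fin n → Bool) {β : Fin n → Ch} t → (∀ j → IsChar (β j)) →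
    (∀ {b} → IsChar b → ¬ b ≈ᶜ ε → binomialKernel b t ≡ 0#) →
    maskedProdK mask β t ≡ 0# ⊎ (∀ j → mask j ≡ false → β j ≈ᶜ ε)
  maskedProdK-0-or-trivial {zero}  mask t βc vanish = inj₂ (λ ())
  maskedProdK-0-or-trivial {suc n} mask {β} t βc vanish
    with maskedProdK-0-or-trivial (λ j → mask (suc j)) t (λ j → βc (suc j)) vanish
  ... | rest with mask zero in mask0
  ...   | true = map⊎ (λ tail≡0 → trans (cong (1# *_) tail≡0) (KP.zeroʳ _))
                              (λ tail-triv → λ { zero e → ⊥-elim (true≢false (trans (sym mask0) e)) ; (suc j) e → tail-triv j e }) rest
    where
    true≢false : true ≢ false
    true≢false ()
  ...   | false with β zero ≈ᶜ? ε
  ...     | no β0≉ε = inj₁ (trans (cong (_* maskedProdK (λ j → mask (suc j)) (λ j → β (suc j)) t) (vanish (βc zero) β0≉ε)) (KP.zeroˡ _))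
  ...     | yes β0≈ε = map⊎ (λ tail≡0 → trans (cong (binomialKernel (β zero) t *_) tail≡0) (KP.zeroʳ _))
                                    (λ tail-triv → λ { zero _ → β0≈ε ; (suc j) e → tail-triv j e }) rest

  private
    maskedProdK-both-vanish : ∀ {n} (mask : Fin n → Bool) {β : Fin n → Ch} t → (∀ j → IsChar (β j)) →
      ¬ maskedProd mask β ≈ᶜ ε → (∀ {b} → IsChar b → ¬ b ≈ᶜ ε → binomialKernel b t ≡ 0#) →
      maskedProdK mask β t ≡ binomialKernel (maskedProd mask β) t
    maskedProdK-both-vanish mask {β} t βc B≉ε vanish with maskedProdK-0-or-trivial mask t βc vanish
    ... | inj₁ prod≡0           = trans prod≡0 (sym (vanish (maskedProd-isChar mask βc) B≉ε))
    ... | inj₂ unmasked-trivial = ⊥-elim (B≉ε (prodCh-trivial _ trivial))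
      where
      trivial : ∀ j → (if mask j then ε else β j) ≈ᶜ ε
      trivial j with mask j in mask-j
      ... | true  = λ _ → refl
      ... | false = unmasked-trivial j mask-j

  -- E_b E_b′ = E_{b b′} away from 0 and 1 by binomialWeight; at 0 and 1 both sides vanish
  maskedProdK≡binomialKernel : ∀ {n} (mask : Fin n → Bool) {β : Fin n → Ch} t → (∀ j → IsChar (β j)) →
    ¬ maskedProd mask β ≈ᶜ ε → maskedProdK mask β t ≡ binomialKernel (maskedProd mask β) t
  maskedProdK≡binomialKernel mask {β} t βc B≉ε = by-cases (t F.≟ F.0#) (t F.≟ F.1#)
    where
    by-cases : Dec (t ≡ F.0#) → Dec (t ≡ F.1#) → maskedProdK mask β t ≡ binomialKernel (maskedProd mask β) t
    by-cases (yes refl) _          = maskedProdK-both-vanish mask t βc B≉ε (λ bc _ → binomialKernel-0 bc)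
    by-cases (no _)     (yes refl) = maskedProdK-both-vanish mask t βc B≉ε binomialKernel-1
    by-cases (no t≢0)   (no t≢1)   = begin
      maskedProdK mask β t
        ≡⟨ prodK-cong pointwise ⟩
      prodK (λ j → binomialWeight (if mask j then ε else β j) t)
        ≡⟨ sym (binomialWeight-prodCh (λ j → if mask j then ε else β j) t t≢0 t≢1) ⟩
      binomialWeight (maskedProd mask β) t
        ≡⟨ sym (binomialKernel-≢1 (maskedProd-isChar mask βc) t t≢1) ⟩
      binomialKernel (maskedProd mask β) t ∎
      where
      pointwise : ∀ j → (if mask j then 1# else binomialKernel (β j) t) ≡ binomialWeight (if mask j then ε else β j) t
      pointwise j with mask j
      ... | true  = sym (binomialWeight-ε t t≢0 t≢1)
      ... | false = binomialKernel-≢1 (βc j) t t≢1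

  prodK-split : ∀ {n i} (i≤n : i ≤ n) (h : Fin n → K.Carrier) →
    prodK h ≡ prodK (λ j → h (inject≤ j i≤n)) * prodK (λ j → if does (toℕ j <? i) then 1# else h j)
  prodK-split {zero}  {zero}  i≤n     h = sym (KP.*-identityˡ 1#)
  prodK-split {suc n} {zero}  i≤n     h = sym (KP.*-identityˡ _)
  prodK-split {suc n} {suc i} (s≤s i≤n) h = begin
    h zero * prodK (λ j → h (suc j))   ≡⟨ cong (h zero *_) (prodK-split i≤n (λ j → h (suc j))) ⟩
    h zero * (A * M)                   ≡⟨ solve 3 (λ H A′ M′ → (H :* (A′ :* M′)) := ((H :* A′) :* (con 1 :* M′))) refl (h zero) A M ⟩
    (h zero * A) * (1# * M)            ∎
    where
    A = prodK (λ j → h (suc (inject≤ j i≤n)))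
    M = prodK (λ j → if does (toℕ j <? i) then 1# else h (suc j))

  prodK-last : ∀ i (c : K.Carrier) → prodK {suc i} (λ j → if does (toℕ j <? i) then 1# else c) ≡ c
  prodK-last zero    c = KP.*-identityʳ c
  prodK-last (suc i) c = trans (KP.*-identityˡ _) (prodK-last i c)

  if-does-else-cong : ∀ {A P : Set} (d : Dec P) {x y y′ : A} → (¬ P → y ≡ y′) →
                      (if does d then x else y) ≡ (if does d then x else y′)
  if-does-else-cong (yes _) _    = refl
  if-does-else-cong (no ¬p) y≡y′ = y≡y′ ¬p

  module _ {A : Set} where
    fillI-< : ∀ {i n} (i<n : i < n) (v : Fin i → A) (x : A) (j′ : Fin n) (j : Fin i) → toℕ j′ ≡ toℕ j → fillI i<n v x j′ ≡ v j
    fillI-< {i} i<n v x j′ j j′≡j with toℕ j′ <? i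
    ... | yes j′<i = cong v (toℕ-injective (trans (toℕ-fromℕ< j′<i) j′≡j))
    ... | no j′≮i  = ⊥-elim (j′≮i (subst (_< i) (sym j′≡j) (toℕ<n j)))

    fillI-≥ : ∀ {i n} (i<n : i < n) (v : Fin i → A) (x : A) (j : Fin n) → ¬ toℕ j < i → fillI i<n v x j ≡ x
    fillI-≥ {i} i<n v x j j≮i with toℕ j <? i
    ... | yes j<i = ⊥-elim (j≮i j<i)
    ... | no _    = refl

    snocI-< : ∀ {i} (v : Fin i → A) (b : A) (j′ : Fin (suc i)) (j : Fin i) → toℕ j′ ≡ toℕ j → snocI v b j′ ≡ v j
    snocI-< {i} v b j′ j j′≡j with toℕ j′ <? i
    ... | yes j′<i = cong v (toℕ-injective (trans (toℕ-fromℕ< j′<i) j′≡j))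
    ... | no j′≮i  = ⊥-elim (j′≮i (subst (_< i) (sym j′≡j) (toℕ<n j)))

    snocI-≥ : ∀ {i} (v : Fin i → A) (b : A) (j : Fin (suc i)) → ¬ toℕ j < i → snocI v b j ≡ b
    snocI-≥ {i} v b j j≮i with toℕ j <? i
    ... | yes j<i = ⊥-elim (j≮i j<i)
    ... | no _    = refl

    snocI-all : ∀ {i} (P : A → Set) {v : Fin i → A} {b : A} → (∀ j → P (v j)) → P b → ∀ j → P (snocI v b j)
    snocI-all {i} P pv pb j with toℕ j <? i
    ... | yes _ = pv _
    ... | no _  = pb

  kernelProd-fillI : ∀ {n i} (i<n : i < n) {β : Fin n → Ch} (λs : Fin i → F.Carrier) x s →
    (∀ j → IsChar (β j)) → ¬ prodFrom i β ≈ᶜ ε →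
    kernelProd s β (fillI i<n λs x) ≡ kernelProd s (takeI i<n β) λs * binomialKernel (prodFrom i β) ((s F.* x) F.⁻¹)
  kernelProd-fillI {n} {i} i<n {β} λs x s βc B≉ε = begin
    kernelProd s β (fillI i<n λs x)
      ≡⟨ prodK-split i≤n (λ j → K (β j) (fillI i<n λs x j)) ⟩
    prodK (λ j → K (β (inject≤ j i≤n)) (fillI i<n λs x (inject≤ j i≤n))) * prodK (λ j → if does (toℕ j <? i) then 1# else K (β j) (fillI i<n λs x j))
      ≡⟨ cong₂ _*_ (prodK-cong (λ j → cong (K (β (inject≤ j i≤n))) (fillI-< i<n λs x (inject≤ j i≤n) j (toℕ-inject≤ j i≤n))))
                   (prodK-cong (λ j → if-does-else-cong (toℕ j <? i) {1#} (λ j≮i → cong (K (β j)) (fillI-≥ i<n λs x j j≮i)))) ⟩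
    kernelProd s (takeI i<n β) λs * maskedProdK (λ j → does (toℕ j <? i)) β ((s F.* x) F.⁻¹)
      ≡⟨ cong (kernelProd s (takeI i<n β) λs *_) (maskedProdK≡binomialKernel _ _ βc B≉ε) ⟩
    kernelProd s (takeI i<n β) λs * binomialKernel (prodFrom i β) ((s F.* x) F.⁻¹) ∎
    where
    i≤n = <⇒≤ i<n
    K : Ch → F.Carrier → K.Carrier
    K b y = binomialKernel b ((s F.* y) F.⁻¹)

  kernelProd-snocI : ∀ {i} (v : Fin i → Ch) b (λs : Fin i → F.Carrier) x s →
    kernelProd s (snocI v b) (snocI λs x) ≡ kernelProd s v λs * binomialKernel b ((s F.* x) F.⁻¹)
  kernelProd-snocI {i} v b λs x s = begin
    kernelProd s (snocI v b) (snocI λs x)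
      ≡⟨ prodK-split i≤1+i (λ j → K (snocI v b j) (snocI λs x j)) ⟩
    prodK (λ j → K (snocI v b (inject≤ j i≤1+i)) (snocI λs x (inject≤ j i≤1+i)))
      * prodK (λ j → if does (toℕ j <? i) then 1# else K (snocI v b j) (snocI λs x j))
      ≡⟨ cong₂ _*_ (prodK-cong (λ j → cong₂ K (snocI-< v b (inject≤ j i≤1+i) j (toℕ-inject≤ j i≤1+i))
                                                (snocI-< λs x (inject≤ j i≤1+i) j (toℕ-inject≤ j i≤1+i))))
                   (prodK-cong (λ j → if-does-else-cong (toℕ j <? i) {1#} (λ j≮i → cong₂ K (snocI-≥ v b j j≮i) (snocI-≥ λs x j j≮i)))) ⟩
    kernelProd s v λs * prodK {suc i} (λ j → if does (toℕ j <? i) then 1# else K b x)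
      ≡⟨ cong (kernelProd s v λs *_) (prodK-last i _) ⟩
    kernelProd s v λs * binomialKernel b ((s F.* x) F.⁻¹) ∎
    where
    i≤1+i = n≤1+n i
    K : Ch → F.Carrier → K.Carrier
    K b y = binomialKernel b ((s F.* y) F.⁻¹)

  -- Evaluation at 1

  gaussFactor : Ch → Ch → Ch → K.Carrier
  gaussFactor α γ B = (g° γ * g (bar (α · B) · γ)) * (g° (bar α · γ) * g° (bar B · γ)) ⁻¹

  -s⁻¹*invOneMinus[s⁻¹] : ∀ s → s ≢ F.0# → s ≢ F.1# → F.- (s F.⁻¹) F.* invOneMinus (s F.⁻¹) ≡ invOneMinus s
  -s⁻¹*invOneMinus[s⁻¹] s s≢0 s≢1 = FP.⁻¹-unique (F.1# F.+ F.- s) (F.- u F.* D F.⁻¹) (begin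
    (F.1# F.+ F.- s) F.* (F.- u F.* D F.⁻¹)   ≡⟨ cong (F._* (F.- u F.* D F.⁻¹)) (sym -s*D≡1-s) ⟩
    (F.- s F.* D) F.* (F.- u F.* D F.⁻¹)      ≡⟨ FP.interchange (F.- s) D (F.- u) (D F.⁻¹) ⟩
    (F.- s F.* F.- u) F.* (D F.* D F.⁻¹)      ≡⟨ cong₂ F._*_ (trans (FP.-x*-y≡x*y s u) (FP.⁻¹-inverseʳ s s≢0)) (FP.⁻¹-inverseʳ D D≢0) ⟩
    F.1# F.* F.1#                             ≡⟨ FP.*-identityˡ F.1# ⟩
    F.1#                                      ∎)
    where
    u = s F.⁻¹
    D = F.1# F.+ F.- u
    D≢0 : D ≢ F.0#
    D≢0 D≡0 = s≢1 (trans (sym (FP.⁻¹-involutive s)) (trans (cong F._⁻¹ u≡1) FP.1⁻¹≡1))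
      where
      u≡1 : u ≡ F.1#
      u≡1 = sym (trans (FP.+-inverseˡ-unique F.1# (F.- u) D≡0) (FP.-‿involutive u))
    -s*D≡1-s : F.- s F.* D ≡ F.1# F.+ F.- s
    -s*D≡1-s = begin
      F.- s F.* (F.1# F.+ F.- u)             ≡⟨ FP.distribˡ _ _ _ ⟩
      F.- s F.* F.1# F.+ F.- s F.* F.- u     ≡⟨ cong₂ F._+_ (FP.*-identityʳ _) (trans (FP.-x*-y≡x*y s u) (FP.⁻¹-inverseʳ s s≢0)) ⟩
      F.- s F.+ F.1#                         ≡⟨ FP.+-comm _ _ ⟩
      F.1# F.+ F.- s                         ∎

  module _ {α γ B : Ch} (αc : IsChar α) (γc : IsChar γ) (Bc : IsChar B) (B≉ε : ¬ B ≈ᶜ ε) (B≉ᾱγ : ¬ B ≈ᶜ (bar α · γ)) where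
    private
      c′  = bar B · γ
      θ   = α · bar γ
      θ′  = α · bar c′
      η₁  = bar α · γ
      η₂  = bar (α · B) · γ
      c′c = ·-isChar (bar-isChar Bc) γc
      θ′c = ·-isChar αc (bar-isChar c′c)
      η₁c = ·-isChar (bar-isChar αc) γc
      η₂c = ·-isChar (bar-isChar (·-isChar αc Bc)) γc
      a₋ = α FP.-1#
      g₋ = γ FP.-1#
      b₋ = B FP.-1#

      [xy⁻¹]⁻¹ : ∀ x y → (x ⁻¹ * y) ⁻¹ ≡ x * y ⁻¹
      [xy⁻¹]⁻¹ x y = trans (KP.⁻¹-distrib-* _ _) (cong (_* y ⁻¹) (KP.⁻¹-involutive x))

      θ′≈θ·B : ∀ x → θ′ x ≡ θ x * B x
      θ′≈θ·B x = trans (cong (α x *_) ([xy⁻¹]⁻¹ (B x) (γ x))) (KP.x∙yz≈xz∙y (α x) (B x) ((γ x) ⁻¹))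

      B≈ᾱγ-if : (∀ x → x ≢ F.0# → α x * (B x * (γ x) ⁻¹) ≡ 1#) → B ≈ᶜ (bar α · γ)
      B≈ᾱγ-if αBγ̄≡1 x with x F.≟ F.0#
      ... | yes refl = trans (IsMChar.at-0 Bc) (sym (trans (cong ((α F.0#) ⁻¹ *_) (IsMChar.at-0 γc)) (KP.zeroʳ _)))
      ... | no x≢0 = begin
        B x                            ≡⟨ sym (KP.*-identityʳ _) ⟩
        B x * 1#                       ≡⟨ cong (B x *_) (sym (KP.⁻¹-inverseˡ _ (char-≢0 γc x x≢0))) ⟩
        B x * ((γ x) ⁻¹ * γ x)         ≡⟨ sym (KP.*-assoc _ _ _) ⟩
        (B x * (γ x) ⁻¹) * γ x         ≡⟨ cong (_* γ x) (KP.*-cancelˡ-⁻¹ (α x) _ _ (char-≢0 αc x x≢0) (αBγ̄≡1 x x≢0)) ⟩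
        ((α x) ⁻¹ * 1#) * γ x          ≡⟨ cong (_* γ x) (KP.*-identityʳ _) ⟩
        (α x) ⁻¹ * γ x                 ∎

      θ′≉ε : ¬ θ′ ≈ᶜ ε
      θ′≉ε θ′≈ε = B≉ᾱγ (B≈ᾱγ-if (λ x x≢0 → trans (sym (cong (α x *_) ([xy⁻¹]⁻¹ (B x) (γ x)))) (trans (θ′≈ε x) (ε-≢0 x x≢0))))

      η₂≉ε : ¬ η₂ ≈ᶜ ε
      η₂≉ε η₂≈ε = B≉ᾱγ (B≈ᾱγ-if (λ x x≢0 → begin
        α x * (B x * (γ x) ⁻¹)        ≡⟨ sym (KP.*-assoc _ _ _) ⟩
        (α x * B x) * (γ x) ⁻¹        ≡⟨ sym ([xy⁻¹]⁻¹ (α x * B x) (γ x)) ⟩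
        ((α x * B x) ⁻¹ * γ x) ⁻¹     ≡⟨ cong _⁻¹ (trans (η₂≈ε x) (ε-≢0 x x≢0)) ⟩
        1# ⁻¹                         ≡⟨ KP.1⁻¹≡1 ⟩
        1#                            ∎))

      g°η₁*gθ : g° η₁ * g θ ≡ (a₋ * g₋) * ι 𝕂 q
      g°η₁*gθ = trans (cong (g° η₁ *_) (g-cong (λ x → sym ([xy⁻¹]⁻¹ (α x) (γ x)))))
                      (trans (g°-reflection η₁c) (cong (λ z → (z * g₋) * ι 𝕂 q) (char[-1]⁻¹ αc)))

      gη₂*gθ′ : g η₂ * g θ′ ≡ ((a₋ * b₋) * g₋) * ι 𝕂 q
      gη₂*gθ′ = begin
        g η₂ * g θ′                        ≡⟨ cong₂ _*_ (sym (g°-nontrivial η₂c η₂≉ε)) (g-cong η̄₂≈θ′) ⟩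
        g° η₂ * g (bar η₂)                 ≡⟨ g°-reflection η₂c ⟩
        ((a₋ * b₋) ⁻¹ * g₋) * ι 𝕂 q        ≡⟨ cong (λ z → (z * g₋) * ι 𝕂 q) (trans (KP.⁻¹-distrib-* _ _) (cong₂ _*_ (char[-1]⁻¹ αc) (char[-1]⁻¹ Bc))) ⟩
        ((a₋ * b₋) * g₋) * ι 𝕂 q           ∎
        where
        η̄₂≈θ′ : θ′ ≈ᶜ bar η₂
        η̄₂≈θ′ x = sym (trans ([xy⁻¹]⁻¹ (α x * B x) (γ x))
                     (trans (KP.*-assoc _ _ _) (cong (α x *_) (sym ([xy⁻¹]⁻¹ (B x) (γ x))))))

      betaScale-shift : betaScale α γ * g θ ≡ gaussFactor α γ B * (betaScale α c′ * (g θ′ * b₋))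
      betaScale-shift = sym (begin
        ((g° γ * g η₂) * (g° η₁ * g° c′) ⁻¹) * (((g α) ⁻¹ * (g° c′ * (ι 𝕂 q) ⁻¹)) * (g θ′ * b₋))
          ≡⟨ cong (λ z → ((g° γ * g η₂) * z) * (((g α) ⁻¹ * (g° c′ * (ι 𝕂 q) ⁻¹)) * (g θ′ * b₋))) (KP.⁻¹-distrib-* _ _) ⟩
        ((g° γ * g η₂) * ((g° η₁) ⁻¹ * (g° c′) ⁻¹)) * (((g α) ⁻¹ * (g° c′ * (ι 𝕂 q) ⁻¹)) * (g θ′ * b₋))
          ≡⟨ solve 9 (λ Gγ Gη Gi Gci Ga Gc Iq Gt Bm → (((Gγ :* Gη) :* (Gi :* Gci)) :* ((Ga :* (Gc :* Iq)) :* (Gt :* Bm)))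
                        := ((Gci :* Gc) :* ((Gη :* Gt) :* ((((Gγ :* Gi) :* Ga) :* Iq) :* Bm)))) refl
                   (g° γ) (g η₂) ((g° η₁) ⁻¹) ((g° c′) ⁻¹) ((g α) ⁻¹) (g° c′) ((ι 𝕂 q) ⁻¹) (g θ′) b₋ ⟩
        ((g° c′) ⁻¹ * g° c′) * ((g η₂ * g θ′) * R)
          ≡⟨ cong₂ (λ u v → u * (v * R)) (KP.⁻¹-inverseˡ _ (g°-≢0 c′c)) gη₂*gθ′ ⟩
        1# * ((((a₋ * b₋) * g₋) * ι 𝕂 q) * R)
          ≡⟨ solve 8 (λ A Bm G I Gγ Gi Ga Iq → (con 1 :* ((((A :* Bm) :* G) :* I) :* ((((Gγ :* Gi) :* Ga) :* Iq) :* Bm)))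
                        := ((Bm :* Bm) :* ((Ga :* (Gγ :* Iq)) :* (Gi :* ((A :* G) :* I))))) refl
                   a₋ b₋ g₋ (ι 𝕂 q) (g° γ) ((g° η₁) ⁻¹) ((g α) ⁻¹) ((ι 𝕂 q) ⁻¹) ⟩
        (b₋ * b₋) * (((g α) ⁻¹ * (g° γ * (ι 𝕂 q) ⁻¹)) * ((g° η₁) ⁻¹ * ((a₋ * g₋) * ι 𝕂 q)))
          ≡⟨ cong₂ (λ u v → u * (((g α) ⁻¹ * (g° γ * (ι 𝕂 q) ⁻¹)) * v)) (char[-1]²≡1 Bc)
                   (sym (KP.*-cancelˡ-⁻¹ (g° η₁) (g θ) _ (g°-≢0 η₁c) g°η₁*gθ)) ⟩
        1# * (((g α) ⁻¹ * (g° γ * (ι 𝕂 q) ⁻¹)) * g θ)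
          ≡⟨ KP.*-identityˡ _ ⟩
        betaScale α γ * g θ ∎)
        where
        R = (((g° γ * (g° η₁) ⁻¹) * (g α) ⁻¹) * (ι 𝕂 q) ⁻¹) * b₋

      betaKernel*binomialKernel-generic : ∀ s → s ≢ F.0# → s ≢ F.1# →
        betaKernel α γ s * binomialKernel B (s F.⁻¹) ≡ gaussFactor α γ B * betaKernel α c′ s
      betaKernel*binomialKernel-generic s s≢0 s≢1 = begin
        betaKernel α γ s * binomialKernel B u
          ≡⟨ cong₂ _*_ (betaKernel-≢1 α γ s s≢1)
                       (trans (binomialKernel-≢1 Bc u u≢1) (trans (sym (IsMChar.mult Bc _ _)) (cong B (-s⁻¹*invOneMinus[s⁻¹] s s≢0 s≢1)))) ⟩
        (betaScale α γ * ((- g θ) * (g₋ * (α (F.- s) * θ w)))) * B w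
          ≡⟨ cong (λ z → (betaScale α γ * (z * (g₋ * (α (F.- s) * θ w)))) * B w) (KP.-x≡-1*x _) ⟩
        (betaScale α γ * ((-1# * g θ) * (g₋ * (α (F.- s) * θ w)))) * B w
          ≡⟨ solve 7 (λ K G M Gm A T Bw → ((K :* ((M :* G) :* (Gm :* (A :* T)))) :* Bw) := ((K :* G) :* ((((M :* Gm) :* A) :* T) :* Bw))) refl
                   (betaScale α γ) (g θ) -1# g₋ (α (F.- s)) (θ w) (B w) ⟩
        (betaScale α γ * g θ) * Z
          ≡⟨ cong (_* Z) betaScale-shift ⟩
        (gaussFactor α γ B * (betaScale α c′ * (g θ′ * b₋))) * Z
          ≡⟨ solve 9 (λ Kt K′ G′ Bm M Gm A T Bw → ((Kt :* (K′ :* (G′ :* Bm))) :* ((((M :* Gm) :* A) :* T) :* Bw))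
                        := (Kt :* (K′ :* ((M :* G′) :* ((Bm :* Gm) :* (A :* (T :* Bw))))))) refl
                   (gaussFactor α γ B) (betaScale α c′) (g θ′) b₋ -1# g₋ (α (F.- s)) (θ w) (B w) ⟩
        gaussFactor α γ B * (betaScale α c′ * ((-1# * g θ′) * ((b₋ * g₋) * (α (F.- s) * (θ w * B w)))))
          ≡⟨ cong₂ (λ u v → gaussFactor α γ B * (betaScale α c′ * (u * (v * (α (F.- s) * (θ w * B w))))))
                   (sym (KP.-x≡-1*x _)) (cong (_* g₋) (sym (char[-1]⁻¹ Bc))) ⟩
        gaussFactor α γ B * (betaScale α c′ * ((- g θ′) * (c′ FP.-1# * (α (F.- s) * (θ w * B w)))))
          ≡⟨ cong (λ z → gaussFactor α γ B * (betaScale α c′ * ((- g θ′) * (c′ FP.-1# * (α (F.- s) * z))))) (sym (θ′≈θ·B w)) ⟩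
        gaussFactor α γ B * (betaScale α c′ * ((- g θ′) * (c′ FP.-1# * (α (F.- s) * θ′ w))))
          ≡⟨ cong (gaussFactor α γ B *_) (sym (betaKernel-≢1 α c′ s s≢1)) ⟩
        gaussFactor α γ B * betaKernel α c′ s ∎
        where
        u = s F.⁻¹
        w = invOneMinus s
        u≢1 : u ≢ F.1#
        u≢1 u≡1 = s≢1 (trans (sym (FP.⁻¹-involutive s)) (trans (cong F._⁻¹ u≡1) FP.1⁻¹≡1))
        Z = (((-1# * g₋) * α (F.- s)) * θ w) * B w

    betaKernel*binomialKernel : ∀ s → betaKernel α γ s * binomialKernel B (s F.⁻¹) ≡ gaussFactor α γ B * betaKernel α c′ s
    betaKernel*binomialKernel s = by-cases (s F.≟ F.0#) (s F.≟ F.1#)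
      where
      by-cases : Dec (s ≡ F.0#) → Dec (s ≡ F.1#) →
                 betaKernel α γ s * binomialKernel B (s F.⁻¹) ≡ gaussFactor α γ B * betaKernel α c′ s
      by-cases (yes refl) _ = trans (cong (_* binomialKernel B (F.0# F.⁻¹)) (betaKernel-0 γ αc))
        (trans (KP.zeroˡ _) (sym (trans (cong (gaussFactor α γ B *_) (betaKernel-0 c′ αc)) (KP.zeroʳ _))))
      by-cases (no _) (yes refl) = trans (cong (λ z → betaKernel α γ F.1# * binomialKernel B z) FP.1⁻¹≡1)
        (trans (cong (betaKernel α γ F.1# *_) (binomialKernel-1 Bc B≉ε))
          (trans (KP.zeroʳ _) (sym (trans (cong (gaussFactor α γ B *_) (betaKernel-1 c′ αc θ′≉ε)) (KP.zeroʳ _)))))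
      by-cases (no s≢0) (no s≢1) = betaKernel*binomialKernel-generic s s≢0 s≢1

  F21≡FD1 : ∀ a b c x → F21 a b c x ≡ FD 1 a (λ _ → b) c (λ _ → x)
  F21≡FD1 a b c x = cong₂ _*_ (cong _⁻¹ (sym (KP.*-identityʳ _))) (sumL-congᴬ chars-char pointwise)
    where
    pointwise : ∀ ν → IsChar ν →
      poch a ν * poch b ν * (poch° ε ν * poch° c ν) ⁻¹ * ν x
        ≡ poch a (ν · ε) * (poch b ν * 1#) * (poch° c (ν · ε) * (poch° ε ν * 1#)) ⁻¹ * (ν x * 1#)
    pointwise ν νc = begin
      poch a ν * poch b ν * (poch° ε ν * poch° c ν) ⁻¹ * ν x
        ≡⟨ cong₂ (λ u v → u * poch b ν * v ⁻¹ * ν x)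
                 (cong (_* (g a) ⁻¹) (g-cong ν≈ν·ε))
                 (trans (KP.*-comm _ _) (cong (λ z → (z * (g° c) ⁻¹) * poch° ε ν) (g°-cong ν≈ν·ε))) ⟩
      poch a (ν · ε) * poch b ν * (poch° c (ν · ε) * poch° ε ν) ⁻¹ * ν x
        ≡⟨ solve 4 (λ A B C E → (A :* B :* C :* E) := (A :* (B :* con 1) :* C :* (E :* con 1))) refl
                 (poch a (ν · ε)) (poch b ν) ((poch° c (ν · ε) * poch° ε ν) ⁻¹) (ν x) ⟩
      poch a (ν · ε) * (poch b ν * 1#) * (poch° c (ν · ε) * poch° ε ν) ⁻¹ * (ν x * 1#)
        ≡⟨ cong (λ z → poch a (ν · ε) * (poch b ν * 1#) * (poch° c (ν · ε) * z) ⁻¹ * (ν x * 1#)) (sym (KP.*-identityʳ _)) ⟩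
      poch a (ν · ε) * (poch b ν * 1#) * (poch° c (ν · ε) * (poch° ε ν * 1#)) ⁻¹ * (ν x * 1#) ∎
      where
      ν≈ν·ε : ∀ {d} → (d · ν) ≈ᶜ (d · (ν · ε))
      ν≈ν·ε {d} y = cong (d y *_) (sym (char·ε≈char νc y))

  module _ {n : ℕ} {α γ : Ch} {β : Fin n → Ch} (αc : IsChar α) (βc : ∀ j → IsChar (β j)) (γc : IsChar γ) where

    FD-fillI : ∀ i (i<n : i < n) (λs : Fin i → F.Carrier) x → ¬ prodFrom i β ≈ᶜ ε →
               FD n α β γ (fillI i<n λs x) ≡ FD (suc i) α (snocI (takeI i<n β) (prodFrom i β)) γ (snocI λs x)
    FD-fillI i i<n λs x B≉ε = begin
      FD n α β γ (fillI i<n λs x)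
        ≡⟨ FD≡Σ𝔽-kernels n αc βc γc (fillI i<n λs _) ⟩
      Σ𝔽 (λ s → betaKernel α γ s * kernelProd s β (fillI i<n λs x))
        ≡⟨ sumL-cong elems (λ s → cong (betaKernel α γ s *_)
             (trans (kernelProd-fillI i<n λs x s βc B≉ε) (sym (kernelProd-snocI (takeI i<n β) (prodFrom i β) λs x s)))) ⟩
      Σ𝔽 (λ s → betaKernel α γ s * kernelProd s (snocI (takeI i<n β) (prodFrom i β)) (snocI λs x))
        ≡⟨ sym (FD≡Σ𝔽-kernels (suc i) αc (snocI-all IsChar (λ j → βc _) (prodFrom-isChar i)) γc (snocI λs x)) ⟩
      FD (suc i) α (snocI (takeI i<n β) (prodFrom i β)) γ (snocI λs x) ∎
      where
      prodFrom-isChar : ∀ i → IsChar (prodFrom i β)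
      prodFrom-isChar i = maskedProd-isChar (λ j → does (toℕ j <? i)) βc

    FD-fillI-1 : ∀ i (i<n : i < n) (λs : Fin i → F.Carrier) → ¬ prodFrom i β ≈ᶜ ε → ¬ prodFrom i β ≈ᶜ (bar α · γ) →
                 FD n α β γ (fillI i<n λs F.1#) ≡ gaussFactor α γ (prodFrom i β) * FD i α (takeI i<n β) (bar (prodFrom i β) · γ) λs
    FD-fillI-1 i i<n λs B≉ε B≉ᾱγ = begin
      FD n α β γ (fillI i<n λs F.1#)
        ≡⟨ FD≡Σ𝔽-kernels n αc βc γc (fillI i<n λs _) ⟩
      Σ𝔽 (λ s → betaKernel α γ s * kernelProd s β (fillI i<n λs F.1#))
        ≡⟨ sumL-cong elems absorb ⟩
      Σ𝔽 (λ s → gaussFactor α γ B * (betaKernel α (bar B · γ) s * kernelProd s (takeI i<n β) λs))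
        ≡⟨ sumL-*ˡ elems _ _ ⟩
      gaussFactor α γ B * Σ𝔽 (λ s → betaKernel α (bar B · γ) s * kernelProd s (takeI i<n β) λs)
        ≡⟨ cong (gaussFactor α γ B *_) (sym (FD≡Σ𝔽-kernels i αc (λ j → βc _) (·-isChar (bar-isChar Bc) γc) λs)) ⟩
      gaussFactor α γ B * FD i α (takeI i<n β) (bar B · γ) λs ∎
      where
      B = prodFrom i β
      Bc = maskedProd-isChar (λ j → does (toℕ j <? i)) βc
      absorb : ∀ s → betaKernel α γ s * kernelProd s β (fillI i<n λs F.1#)
                     ≡ gaussFactor α γ B * (betaKernel α (bar B · γ) s * kernelProd s (takeI i<n β) λs)
      absorb s = begin
        betaKernel α γ s * kernelProd s β (fillI i<n λs F.1#)
          ≡⟨ cong (betaKernel α γ s *_) (kernelProd-fillI i<n λs F.1# s βc B≉ε) ⟩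
        betaKernel α γ s * (kernelProd s (takeI i<n β) λs * binomialKernel B ((s F.* F.1#) F.⁻¹))
          ≡⟨ cong (λ z → betaKernel α γ s * (kernelProd s (takeI i<n β) λs * binomialKernel B (z F.⁻¹))) (FP.*-identityʳ s) ⟩
        betaKernel α γ s * (kernelProd s (takeI i<n β) λs * binomialKernel B (s F.⁻¹))
          ≡⟨ KP.x∙yz≈xz∙y _ _ _ ⟩
        (betaKernel α γ s * binomialKernel B (s F.⁻¹)) * kernelProd s (takeI i<n β) λs
          ≡⟨ cong (_* kernelProd s (takeI i<n β) λs) (betaKernel*binomialKernel αc γc Bc B≉ε B≉ᾱγ s) ⟩
        (gaussFactor α γ B * betaKernel α (bar B · γ) s) * kernelProd s (takeI i<n β) λs
          ≡⟨ KP.*-assoc _ _ _ ⟩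
        gaussFactor α γ B * (betaKernel α (bar B · γ) s * kernelProd s (takeI i<n β) λs) ∎

theorem3p23 :
    (S : Setting) →
    let open Setting S
        open Theory S
    in
    (n : ℕ) → 1 ≤ n →
    (α : Ch) (β : Fin n → Ch) (γ : Ch) →
    IsMChar 𝔽 𝕂 α → (∀ j → IsMChar 𝔽 𝕂 (β j)) → IsMChar 𝔽 𝕂 γ →
    -- (i)
    ((i : ℕ) (i<n : i < n) (λs : Fin i → F.Carrier) (x : F.Carrier) →
      let B = prodFrom i β in
      ¬ (_≗ᶜ_ 𝔽 𝕂 B ε) →
      FD n α β γ (fillI i<n λs x)
        ≡ FD (suc i) α (snocI (takeI i<n β) B) γ (snocI λs x))
    ×
    -- (i), in particular
    ((x : F.Carrier) →
      ¬ (_≗ᶜ_ 𝔽 𝕂 (prodCh β) ε) →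
      FD n α β γ (const x) ≡ F21 α (prodCh β) γ x)
    ×
    -- (ii)
    ((i : ℕ) (i<n : i < n) (λs : Fin i → F.Carrier) →
      let B = prodFrom i β in
      ¬ (_≗ᶜ_ 𝔽 𝕂 B ε) → ¬ (_≗ᶜ_ 𝔽 𝕂 B (bar α · γ)) →
      FD n α β γ (fillI i<n λs F.1#)
        ≡ (g° γ K.* g (bar (α · B) · γ))
            K.* (g° (bar α · γ) K.* g° (bar B · γ)) K.⁻¹
            K.* FD i α (takeI i<n β) (bar B · γ) λs)
    ×
    -- (ii), in particular
    (let C = prodCh β in
      ¬ (_≗ᶜ_ 𝔽 𝕂 C ε) → ¬ (_≗ᶜ_ 𝔽 𝕂 C (bar α · γ)) →
      FD n α β γ (const F.1#)
        ≡ (g° γ K.* g (bar (α · C) · γ))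
            K.* (g° (bar α · γ) K.* g° (bar C · γ)) K.⁻¹)
-- The two special cases are the instances i = 0, where B = β₁⋯βₙ.
theorem3p23 S n 1≤n α β γ αc βc γc =
    FD-fillI S αc βc γc
  , (λ x C≉ε → trans (FD-fillI S αc βc γc 0 1≤n (λ ()) x C≉ε) (sym (F21≡FD1 S α (Theory.prodCh S β) γ x)))
  , FD-fillI-1 S αc βc γc
  , (λ C≉ε C≉ᾱγ → trans (FD-fillI-1 S αc βc γc 0 1≤n (λ ()) C≉ε C≉ᾱγ) (FieldProperties.*-identityʳ (Setting.𝕂 S) _))
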